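{- For a full QBF $\phi$ and $Q\in\{\exists,\forall\}$ with dual $Q'$, define $\mathrm{Tr}_Q(\phi)=\phi$ if $\phi$ is boolean, and otherwise $\mathrm{Tr}_Q(\phi) = Q'\,(P(\phi)\cup N(\psi))\,\mathrm{Tr}_{Q'}(\psi)$ where $\psi = T_Q(\phi)$ (with $T_Q$, $N$, $P$ as defined in the context, using fresh variables at every application). Further, writing $\phi=\beta[p_1/Q_1X_1\phi_1,\dots,p_k/Q_kX_k\phi_k]$ as in the context, define $\mathrm{Tr}_{mc}(\phi) = \beta[p_1/Q_1(X_1\cup N(\phi_1))\,\mathrm{Tr}_{Q_1}(\phi_1),\dots,p_k/Q_k(X_k\cup N(\phi_k))\,\mathrm{Tr}_{Q_k}(\phi_k)]$. Then for every full QBF $\phi$: $\phi$ and $\mathrm{Tr}_\exists(\phi)$ are equisatisfiable, $\phi$ and $\mathrm{Tr}_\forall(\phi)$ are equivalid, and $\phi\equiv\mathrm{Tr}_{mc}(\phi)$. Moreover, for $Q\in\{\exists,\forall\}$: (1) $\mathrm{Tr}_Q(\phi)$ is in prenex form and $\mathrm{Tr}_{mc}(\phi)$ is a boolean combination of prenex formulas; (2) $d(\mathrm{Tr}_Q(\phi)) = d(\mathrm{Tr}_{mc}(\phi)) = d(\phi)$; (3) the lengths of $\mathrm{Tr}_Q(\phi)$ and $\mathrm{Tr}_{mc}(\phi)$ are linear in the length of $\phi$ (bounded by $c\,|\phi|$ for a constant $c$ independent of $\phi$).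
   Context: Fix a countably infinite set $\mathcal P$ of propositional variables and a set of boolean operators; each $k$-ary operator $\mathbf f^k$ ($k\ge 0$) is interpreted by a boolean function $f^k:\{0,1\}^k\to\{0,1\}$, and the operators include $\bot$, $\lnot$, $\land$, $\rightarrow$, $\leftrightarrow$ with their usual meaning. Full QBFs form the smallest set containing every $p\in\mathcal P$, containing $\mathbf f^k(\phi_1,\dots,\phi_k)$ whenever it contains $\phi_1,\dots,\phi_k$, and containing $\exists X\phi$ and $\forall X\phi$ whenever it contains $\phi$ and $X$ is a finite (possibly empty) subset of $\mathcal P$. Boolean formulas are those without quantifiers. A valuation is a map $V:\mathcal P\to\{0,1\}$, extended by $V(\mathbf f^k(\phi_1,\dots,\phi_k)) = f^k(V(\phi_1),\dots,V(\phi_k))$, $V(\exists X\phi)=1$ iff $V'(\phi)=1$ for some $V'$ agreeing with $V$ on $\mathcal P\setminus X$, and $V(\forall X\phi)=1$ iff $V'(\phi)=1$ for every such $V'$. $\phi$ is satisfiable if $V(\phi)=1$ for some $V$, valid if for all $V$; $\phi\equiv\psi$ means $V(\phi)=V(\psi)$ for all $V$; equisatisfiable (equivalid) means one is satisfiable (valid) iff the other is. A formula is in prenex form if it is a sequence of quantifier blocks $\exists X$/$\forall Y$ followed by a boolean formula. Length: $|p|=1$, $|\mathbf f^n(\phi_1,\dots,\phi_n)| = 1+\sum_i|\phi_i|$, $|QX\phi| = 1+|X|+|\phi|$. Quantifier depth: $d(p)=0$, $d(\mathbf f^n(\phi_1,\dots,\phi_n))=\max_i d(\phi_i)$ ($0$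 if $n=0$), $d(QX\phi)=1+d(\phi)$. $\mathrm{FV}$ denotes free variables and $\phi[p_1/\psi_1,\dots]$ simultaneous substitution for free occurrences. Decomposition: every full QBF $\phi$ can be written $\phi = \beta[p_1/Q_1X_1\phi_1,\dots,p_k/Q_kX_k\phi_k]$ with $\beta$ boolean, $Q_i\in\{\exists,\forall\}$, pairwise distinct $p_i$ with $p_i\notin\bigcup_j\mathrm{FV}(\phi_j)$, $|\phi| = |\beta|+\sum_i|X_i|+\sum_i|\phi_i|$, $d(\phi)=\max_i(1+d(\phi_i))$ (the $Q_iX_i\phi_i$ are the outermost quantified subformula occurrences; $k=0$ iff $\phi$ is boolean). Given such a decomposition, for each $i\le k$ and $x\in X_i$ take fresh variables $x_i^+,x_i^-$, let $\sigma_i = \{x/x_i^+ : x\in X_i\}$, and $A = (\bigwedge_{i\le k}(p_i\leftrightarrow\phi_i[\sigma_i]))\land\bigwedge_{i\le k, Q_i=\exists}(\lnot p_i\rightarrow\bigwedge_{x\in X_i}(x_i^+\leftrightarrow x_i^-))\land\bigwedge_{i\le k,Q_i=\forall}(p_i\rightarrow\bigwedge_{x\in X_i}(x_i^+\leftrightarrow x_i^-))$ (empty conjunctions are $\top$). Then $T_\forall(\phi)=A\land\beta$, $T_\exists(\phi)=A\rightarrow\beta$, $N(\phi)=\{x_i^-: x\in X_i, i\le k\}$, $P(\phi)=\{x_i^+ : x\in X_i, i\le k\}\cup\{p_i: i\le k\}$. $Q\,S\,\chi$ with a set $S$ denotes a single quantifier block over $S$. -}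

module Defs where

open import Data.Nat using (ℕ; zero; suc; _+_; _⊔_)
open import Data.Nat.Properties using (_≟_)
open import Data.Bool using (Bool; true; false; not; _∧_; _∨_; _xor_; if_then_else_)
open import Data.List using (List; []; _∷_; _++_; map; concatMap; length; zip; zipWith; upTo; deduplicate; foldr)
open import Data.Vec using (Vec; []; _∷_)
open import Data.Vec.Relation.Unary.All using (All)
open import Data.Product using (_×_; _,_; proj₁; proj₂)
open import Relation.Binary.PropositionalEquality using (_≡_)
open import Relation.Nullary using (yes; no)
import Data.List.Membership.DecPropositional

record Signature : Set₁ where
  field
    Op     : ℕ → Set
    ⟦_⟧    : ∀ {k} → Op k → Vec Bool k → Bool
    bot    : Op 0
    neg    : Op 1
    conj   : Op 2
    impl   : Op 2
    biimp  : Op 2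
    bot-sem   : ⟦ bot ⟧ [] ≡ false
    neg-sem   : ∀ a → ⟦ neg ⟧ (a ∷ []) ≡ not a
    conj-sem  : ∀ a b → ⟦ conj ⟧ (a ∷ b ∷ []) ≡ (a ∧ b)
    impl-sem  : ∀ a b → ⟦ impl ⟧ (a ∷ b ∷ []) ≡ (not a ∨ b)
    biimp-sem : ∀ a b → ⟦ biimp ⟧ (a ∷ b ∷ []) ≡ not (a xor b)

data Quant : Set where
  ex all : Quant

dual : Quant → Quant
dual ex  = all
dual all = ex

-- A finite set X of variables in a quantifier block is given by a list;
-- its cardinality is the length of the list with duplicates removed.

dedup : List ℕ → List ℕ
dedup = deduplicate _≟_

module QBF (S : Signature) where
  open Signature S

  data Formula : Set where
    var : ℕ → Formula
    op  : ∀ {k} → Op k → Vec Formula k → Formula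
    qb  : Quant → List ℕ → Formula → Formula

  ⊥f : Formula
  ⊥f = op bot []
  ¬f : Formula → Formula
  ¬f a = op neg (a ∷ [])
  ⊤f : Formula
  ⊤f = ¬f ⊥f
  _∧f_ _⇒f_ _⇔f_ : Formula → Formula → Formula
  a ∧f b = op conj (a ∷ b ∷ [])
  a ⇒f b = op impl (a ∷ b ∷ [])
  a ⇔f b = op biimp (a ∷ b ∷ [])

  ⋀ : List Formula → Formula
  ⋀ []           = ⊤f
  ⋀ (a ∷ [])     = a
  ⋀ (a ∷ b ∷ as) = a ∧f ⋀ (b ∷ as)

  Valuation : Set
  Valuation = ℕ → Bool

  _[_≔_] : Valuation → ℕ → Bool → Valuation
  (V [ x ≔ v ]) y with x ≟ y
  ... | yes _ = v
  ... | no  _ = V y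

  evalQ : Quant → List ℕ → Valuation → (Valuation → Bool) → Bool
  evalQ q   []       V k = k V
  evalQ ex  (x ∷ xs) V k = evalQ ex  xs (V [ x ≔ true ]) k ∨ evalQ ex  xs (V [ x ≔ false ]) k
  evalQ all (x ∷ xs) V k = evalQ all xs (V [ x ≔ true ]) k ∧ evalQ all xs (V [ x ≔ false ]) k

  mutual
    eval : Valuation → Formula → Bool
    eval V (var x)    = V x
    eval V (op o as)  = ⟦ o ⟧ (evalVec V as)
    eval V (qb q X φ) = evalQ q X V (λ W → eval W φ)

    evalVec : ∀ {k} → Valuation → Vec Formula k → Vec Bool k
    evalVec V []       = []
    evalVec V (a ∷ as) = eval V a ∷ evalVec V as

  Satisfiable : Formula → Set
  Satisfiable φ = Data.Product.Σ Valuation (λ V → eval V φ ≡ true)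

  Valid : Formula → Set
  Valid φ = ∀ V → eval V φ ≡ true

  _≋_ : Formula → Formula → Set
  φ ≋ ψ = ∀ V → eval V φ ≡ eval V ψ

  mutual
    size : Formula → ℕ
    size (var x)    = 1
    size (op o as)  = suc (sizeVec as)
    size (qb q X φ) = suc (length (dedup X) + size φ)

    sizeVec : ∀ {k} → Vec Formula k → ℕ
    sizeVec []       = 0
    sizeVec (a ∷ as) = size a + sizeVec as

  mutual
    depth : Formula → ℕ
    depth (var x)    = 0
    depth (op o as)  = depthVec as
    depth (qb q X φ) = suc (depth φ)

    depthVec : ∀ {k} → Vec Formula k → ℕ
    depthVec []       = 0
    depthVec (a ∷ as) = depth a ⊔ depthVec as

  mutual
    isBool : Formula → Bool
    isBool (var x)    = true
    isBool (op o as)  = isBoolVec as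
    isBool (qb q X φ) = false

    isBoolVec : ∀ {k} → Vec Formula k → Bool
    isBoolVec []       = true
    isBoolVec (a ∷ as) = isBool a ∧ isBoolVec as

  Boolean : Formula → Set
  Boolean φ = isBool φ ≡ true

  data Prenex : Formula → Set where
    prenex-bool  : ∀ {φ} → Boolean φ → Prenex φ
    prenex-quant : ∀ {q X φ} → Prenex φ → Prenex (qb q X φ)

  data BoolCombPrenex : Formula → Set where
    bcp-var   : ∀ {x} → BoolCombPrenex (var x)
    bcp-op    : ∀ {k} {o : Op k} {as} → All BoolCombPrenex as → BoolCombPrenex (op o as)
    bcp-quant : ∀ {q X φ} → Prenex (qb q X φ) → BoolCombPrenex (qb q X φ)

  mutual
    bound : Formula → ℕ
    bound (var x)    = suc x
    bound (op o as)  = boundVec as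
    bound (qb q X φ) = foldr (λ x m → suc x ⊔ m) 0 X ⊔ bound φ

    boundVec : ∀ {k} → Vec Formula k → ℕ
    boundVec []       = 0
    boundVec (a ∷ as) = bound a ⊔ boundVec as

  lookupRen : List (ℕ × ℕ) → ℕ → ℕ
  lookupRen []             y = y
  lookupRen ((x , z) ∷ σ) y with x ≟ y
  ... | yes _ = z
  ... | no  _ = lookupRen σ y

  removeRen : List ℕ → List (ℕ × ℕ) → List (ℕ × ℕ)
  removeRen X [] = []
  removeRen X ((x , z) ∷ σ) with Data.List.Membership.DecPropositional._∈?_ _≟_ x X
  ... | yes _ = removeRen X σ
  ... | no  _ = (x , z) ∷ removeRen X σ

  -- φ[σ]: substitution of variables for the FREE occurrences of variables
  -- (σ's targets are always fresh, so no capture can occur)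
  mutual
    rename : List (ℕ × ℕ) → Formula → Formula
    rename σ (var x)    = var (lookupRen σ x)
    rename σ (op o as)  = op o (renameVec σ as)
    rename σ (qb q X φ) = qb q X (rename (removeRen X σ) φ)

    renameVec : ∀ {k} → List (ℕ × ℕ) → Vec Formula k → Vec Formula k
    renameVec σ []       = []
    renameVec σ (a ∷ as) = rename σ a ∷ renameVec σ as

  -- one outermost quantified subformula occurrence Q_i X_i φ_i together
  -- with its fresh variables p_i and x_i^+, x_i^- (x ∈ X_i)
  record Item : Set where
    constructor item
    field
      quant : Quant
      pvar  : ℕ
      vars  : List ℕ         -- X_i (duplicate free)
      body  : Formula
      plus  : List ℕ         -- x_i^+ for x ∈ X_i (same order)
      minus : List ℕ         -- x_i^- for x ∈ X_i (same order)
  open Item public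

  mutual
    decomp : ℕ → Formula → Formula × List Item × ℕ
    decomp c (var x)    = var x , [] , c
    decomp c (op o as)  with decompVec c as
    ... | bs , its , c' = op o bs , its , c'
    decomp c (qb q X φ) =
      let X' = dedup X
          n  = length X'
      in var c
         , item q c X' φ (map (λ j → suc c + j) (upTo n)) (map (λ j → suc c + n + j) (upTo n)) ∷ []
         , suc c + n + n

    decompVec : ∀ {k} → ℕ → Vec Formula k → Vec Formula k × List Item × ℕ
    decompVec c []       = [] , [] , c
    decompVec c (a ∷ as) with decomp c a
    ... | b , its , c' with decompVec c' as
    ... | bs , its' , c'' = (b ∷ bs) , its ++ its' , c''

  record Step : Set where
    constructor mkStep
    field
      beta  : Formula
      items : List Item
  open Step public

  step : ℕ → Formula → Step
  step b φ with decomp (b ⊔ bound φ) φ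
  ... | β , its , _ = mkStep β its

  σ : Item → List (ℕ × ℕ)
  σ it = zip (vars it) (plus it)

  eqs : Item → Formula
  eqs it = ⋀ (zipWith (λ a b → var a ⇔f var b) (plus it) (minus it))

  defs : List Item → List Formula
  defs = map (λ it → var (pvar it) ⇔f rename (σ it) (body it))

  exGuards : List Item → List Formula
  exGuards []         = []
  exGuards (it ∷ its) with quant it
  ... | ex  = (¬f (var (pvar it)) ⇒f eqs it) ∷ exGuards its
  ... | all = exGuards its

  allGuards : List Item → List Formula
  allGuards []         = []
  allGuards (it ∷ its) with quant it
  ... | ex  = allGuards its
  ... | all = (var (pvar it) ⇒f eqs it) ∷ allGuards its

  A : Step → Formula
  A r = ⋀ (defs (items r)) ∧f (⋀ (exGuards (items r)) ∧f ⋀ (allGuards (items r)))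

  T : Quant → Step → Formula
  T all r = A r ∧f beta r
  T ex  r = A r ⇒f beta r

  N : Step → List ℕ
  N r = concatMap minus (items r)

  P : Step → List ℕ
  P r = map pvar (items r) ++ concatMap plus (items r)

  -- TrAux Q n b φ = Tr_Q(φ) with fresh variables taken above b (and above
  -- all variables of the formula at hand); n is recursion fuel, always
  -- called with n = depth φ (depth decreases by one at each step).
  TrAux : Quant → ℕ → ℕ → Formula → Formula
  TrAux Q zero    b φ = φ
  TrAux Q (suc n) b φ =
    if isBool φ then φ
    else (let r  = step b φ
              ψ  = T Q r
          in qb (dual Q) (P r ++ N (step b ψ)) (TrAux (dual Q) n b ψ))

  Tr : Quant → Formula → Formula
  Tr Q φ = TrAux Q (depth φ) 0 φ

  mutual
    mcAux : ℕ → Formula → Formula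
    mcAux b (var x)    = var x
    mcAux b (op o as)  = op o (mcAuxVec b as)
    mcAux b (qb q X φ) = qb q (dedup X ++ N (step b φ)) (TrAux q (depth φ) b φ)

    mcAuxVec : ∀ {k} → ℕ → Vec Formula k → Vec Formula k
    mcAuxVec b []       = []
    mcAuxVec b (a ∷ as) = mcAux b a ∷ mcAuxVec b as

  Trmc : Formula → Formula
  Trmc φ = mcAux (bound φ) φ

{-# OPTIONS --safe #-}
-- Write φ = β[p_i / Q_i X_i φ_i]. The constraint A defines p_i as φ_i read on the copies x⁺ of X_i,
-- and its guard forces x⁺ = x⁻ when p_i takes the value (false for ∃, true for ∀) at which
-- Q_i X_i φ_i leaves φ_i constant on X_i. Whatever the x⁻ are, giving each p_i the value of
-- Q_i X_i φ_i and each x⁺ either the value of x⁻ or that of a witness satisfies A; and when the x⁻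
-- hold witnesses, A forces every p_i to that value. In both cases β evaluates like φ, so
-- Q N Q' P T_Q(φ) ≡ φ with Q' the dual of Q. Since T_Q(φ) has depth one less, iterating gives
-- Q N(φ) Tr_Q(φ) ≡ φ, whence equisatisfiability, equivalidity and Tr_mc(φ) ≡ φ.
-- For the length, a step adds O(1) symbols per quantifier and per quantified variable of the
-- outermost blocks, and those disappear from T_Q(φ); so size + 10 · (quantifiers + quantified
-- variables) + 10 · depth pays for the whole translation, giving the bound 21 |φ|.

module Submission where

open import Defs
open import Data.Nat using (ℕ; zero; suc; _+_; _*_; _∸_; _⊔_; _<_; _≤_; z≤n; s≤s; s≤s⁻¹)
open import Data.Nat.Properties
open import Data.Nat.Tactic.RingSolver using (solve-∀)
open import Data.Nat.ListAction using (sum)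
open import Data.Nat.ListAction.Properties using (sum-++)
open import Data.Bool using (Bool; true; false; not; _∧_; _∨_; _xor_; if_then_else_)
open import Data.Bool.Properties using (not-involutive; ∨-zeroʳ; ∧-conicalˡ; ∧-conicalʳ; ¬-not; xor-same; xor-inverseˡ)
open import Data.List using (List; []; _∷_; _++_; map; concatMap; length; zip; zipWith; upTo; applyUpTo; foldr)
open import Data.List.Properties
  using (++-conicalˡ; ++-conicalʳ; length-++; length-map; length-upTo; length-deduplicate; map-applyUpTo; map-++)
open import Data.List.Membership.Propositional using (_∈_; _∉_)
open import Data.List.Membership.Propositional.Properties
  using (∈-++⁻; ∈-++⁺ˡ; ∈-++⁺ʳ; ∈-map⁻; ∈-map⁺; ∈-upTo⁻; ∈-upTo⁺; deduplicate-∈⇔)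
import Data.List.Membership.DecPropositional as DecMembership
open import Data.List.Relation.Unary.Any using (here; there)
open import Data.List.Relation.Unary.All as All using (All; []; _∷_)
import Data.List.Relation.Unary.All.Properties as All
import Data.Vec.Relation.Unary.All as VecAll
open import Data.Vec using (Vec; []; _∷_)
open import Data.Product using (Σ; ∃; _×_; _,_; proj₁; proj₂)
open import Data.Sum using (_⊎_; inj₁; inj₂)
open import Data.Empty using (⊥-elim)
open import Function.Bundles using (_⇔_; mk⇔; Equivalence)
open import Relation.Nullary using (Dec; yes; no)
open import Relation.Binary.PropositionalEquality
  using (_≡_; _≢_; _≗_; refl; sym; trans; cong; cong₂; subst; subst₂; module ≡-Reasoning)

≡-from-truth : ∀ {a b : Bool} → (a ≡ true → b ≡ true) → (b ≡ true → a ≡ true) → a ≡ b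
≡-from-truth {false} {false} _ _ = refl
≡-from-truth {false} {true}  _ g = g refl
≡-from-truth {true}  {false} f _ = sym (f refl)
≡-from-truth {true}  {true}  _ _ = refl

∧-intro : ∀ {a b} → a ≡ true → b ≡ true → (a ∧ b) ≡ true
∧-intro refl refl = refl

not-xor≡true⇒≡ : ∀ {a b} → not (a xor b) ≡ true → a ≡ b
not-xor≡true⇒≡ {false} {false} _ = refl
not-xor≡true⇒≡ {true}  {true}  _ = refl

≡⇒not-xor≡true : ∀ {a b} → a ≡ b → not (a xor b) ≡ true
≡⇒not-xor≡true {false} refl = refl
≡⇒not-xor≡true {true}  refl = refl

not-∨-elim : ∀ {a b} → (not a ∨ b) ≡ true → a ≡ true → b ≡ true
not-∨-elim h refl = h

not-∨-intro : ∀ {a b} → (a ≡ true → b ≡ true) → (not a ∨ b) ≡ true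
not-∨-intro {false} _ = refl
not-∨-intro {true}  h = h refl

≡-or-≡not : ∀ b p → b ≡ p ⊎ b ≡ not p
≡-or-≡not false false = inj₁ refl
≡-or-≡not false true  = inj₂ refl
≡-or-≡not true  false = inj₂ refl
≡-or-≡not true  true  = inj₁ refl

not-≢-self : ∀ p → not p ≢ p
not-≢-self false ()
not-≢-self true  ()

block : ℕ → ℕ → List ℕ
block a n = map (λ j → a + j) (upTo n)

range : ℕ → ℕ → List ℕ
range a zero    = []
range a (suc n) = a ∷ range (suc a) n

block≡range : ∀ a n → block a n ≡ range a n
block≡range a n = trans (map-applyUpTo (λ j → j) (λ j → a + j) n) (applyUpTo-shift n a (λ j → refl))
  where
  applyUpTo-shift : ∀ n a {f : ℕ → ℕ} → (∀ j → f j ≡ a + j) → applyUpTo f n ≡ range a n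
  applyUpTo-shift zero    a f≗ = refl
  applyUpTo-shift (suc n) a f≗ =
    cong₂ _∷_ (trans (f≗ 0) (+-identityʳ a)) (applyUpTo-shift n (suc a) (λ j → trans (f≗ (suc j)) (+-suc a j)))

∈-block⁻ : ∀ {y} a n → y ∈ block a n → a ≤ y × y < a + n
∈-block⁻ a n y∈ with ∈-map⁻ (λ j → a + j) y∈
... | j , j∈ , refl = m≤m+n a j , +-monoʳ-< a (∈-upTo⁻ j∈)

∈-block⁺ : ∀ a n {j} → j < n → a + j ∈ block a n
∈-block⁺ a n j< = ∈-map⁺ (λ j → a + j) (∈-upTo⁺ j<)

∉-block⁻ : ∀ {y} a n → y ∉ block a n → y < a ⊎ a + n ≤ y
∉-block⁻ {y} a n y∉ with a ≤? y | y <? a + n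
... | no a≰y  | _      = inj₁ (≰⇒> a≰y)
... | yes _   | no y≮  = inj₂ (≮⇒≥ y≮)
... | yes a≤y | yes y< = ⊥-elim (y∉ (subst (_∈ block a n) (m+[n∸m]≡n a≤y)
      (∈-block⁺ a n (+-cancelˡ-< a _ _ (subst (_< a + n) (sym (m+[n∸m]≡n a≤y)) y<)))))

length-block : ∀ a n → length (block a n) ≡ n
length-block a n = trans (length-map (λ j → a + j) (upTo n)) (length-upTo n)

-- junk value 0 past the end of the list
nth : List ℕ → ℕ → ℕ
nth []      j       = 0
nth (x ∷ X) zero    = x
nth (x ∷ X) (suc j) = nth X j

module Translation (S : Signature) where
  open Signature S
  open QBF S

  _∈?_ : (x : ℕ) (xs : List ℕ) → Dec (x ∈ xs)
  _∈?_ = DecMembership._∈?_ _≟_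

  -- Quantifier blocks

  _⊨_ : Valuation → Formula → Set
  W ⊨ f = eval W f ≡ true

  Extensional : (Valuation → Bool) → Set
  Extensional k = ∀ U U' → U ≗ U' → k U ≡ k U'

  AgreeOff : List ℕ → Valuation → Valuation → Set
  AgreeOff X U V = ∀ y → y ∉ X → U y ≡ V y

  Extensional-not : ∀ {k} → Extensional k → Extensional (λ U → not (k U))
  Extensional-not e U U' U≗U' = cong not (e U U' U≗U')

  ≔-same : ∀ (V : Valuation) x v → (V [ x ≔ v ]) x ≡ v
  ≔-same V x v with x ≟ x
  ... | yes _ = refl
  ... | no x≢x = ⊥-elim (x≢x refl)

  ≔-other : ∀ (V : Valuation) x v y → x ≢ y → (V [ x ≔ v ]) y ≡ V y
  ≔-other V x v y x≢y with x ≟ y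
  ... | yes x≡y = ⊥-elim (x≢y x≡y)
  ... | no _ = refl

  ≔-cong : ∀ (U U' : Valuation) x v y → (x ≢ y → U y ≡ U' y) → (U [ x ≔ v ]) y ≡ (U' [ x ≔ v ]) y
  ≔-cong U U' x v y h with x ≟ y
  ... | yes _ = refl
  ... | no x≢y = h x≢y

  evalQ-simulation : (R : List ℕ → Valuation → Valuation → Set)
    → (∀ x Y U U' v → R (x ∷ Y) U U' → R Y (U [ x ≔ v ]) (U' [ x ≔ v ]))
    → ∀ {k k'} → (∀ U U' → R [] U U' → k U ≡ k' U')
    → ∀ q X V V' → R X V V' → evalQ q X V k ≡ evalQ q X V' k'
  evalQ-simulation R next done q [] V V' r = done V V' r
  evalQ-simulation R next done ex (x ∷ X) V V' r =
    cong₂ _∨_ (evalQ-simulation R next done ex X _ _ (next x X V V' true r))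
              (evalQ-simulation R next done ex X _ _ (next x X V V' false r))
  evalQ-simulation R next done all (x ∷ X) V V' r =
    cong₂ _∧_ (evalQ-simulation R next done all X _ _ (next x X V V' true r))
              (evalQ-simulation R next done all X _ _ (next x X V V' false r))

  evalQ-cong : ∀ {k k'} → (∀ U → k U ≡ k' U) → ∀ q X V → evalQ q X V k ≡ evalQ q X V k'
  evalQ-cong h q X V =
    evalQ-simulation (λ _ U U' → U ≡ U') (λ { _ _ _ _ _ refl → refl }) (λ { U _ refl → h U }) q X V V refl

  evalQ-extensional : ∀ {k} → Extensional k → ∀ q X → Extensional (λ V → evalQ q X V k)
  evalQ-extensional e q X V V' V≗V' =
    evalQ-simulation (λ _ U U' → U ≗ U') (λ x _ U U' v r y → ≔-cong U U' x v y (λ _ → r y)) e q X V V' V≗V'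

  evalQ-++ : ∀ q X Y V k → evalQ q (X ++ Y) V k ≡ evalQ q X V (λ U → evalQ q Y U k)
  evalQ-++ q   []      Y V k = refl
  evalQ-++ ex  (x ∷ X) Y V k = cong₂ _∨_ (evalQ-++ ex X Y _ k) (evalQ-++ ex X Y _ k)
  evalQ-++ all (x ∷ X) Y V k = cong₂ _∧_ (evalQ-++ all X Y _ k) (evalQ-++ all X Y _ k)

  witness : List ℕ → Valuation → (Valuation → Bool) → Valuation
  witness []      V k = V
  witness (x ∷ X) V k =
    if evalQ ex X (V [ x ≔ true ]) k then witness X (V [ x ≔ true ]) k else witness X (V [ x ≔ false ]) k

  witness-value : ∀ X V k → k (witness X V k) ≡ evalQ ex X V k
  witness-value []      V k = refl
  witness-value (x ∷ X) V k with evalQ ex X (V [ x ≔ true ]) k in eq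
  ... | true  = trans (witness-value X _ k) eq
  ... | false = witness-value X _ k

  witness-agrees : ∀ X V k → AgreeOff X (witness X V k) V
  witness-agrees []      V k y _ = refl
  witness-agrees (x ∷ X) V k y y∉ with evalQ ex X (V [ x ≔ true ]) k
  ... | true  = trans (witness-agrees X _ k y (λ m → y∉ (there m))) (≔-other V x true y (λ e → y∉ (here (sym e))))
  ... | false = trans (witness-agrees X _ k y (λ m → y∉ (there m))) (≔-other V x false y (λ e → y∉ (here (sym e))))

  ∃-elim : ∀ {k} X V → evalQ ex X V k ≡ true → Σ Valuation (λ U → AgreeOff X U V × k U ≡ true)
  ∃-elim {k} X V h = witness X V k , witness-agrees X V k , trans (witness-value X V k) h

  ∃-intro : ∀ {k} → Extensional k → ∀ X V U → AgreeOff X U V → k U ≡ true → evalQ ex X V k ≡ true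
  ∃-intro e []      V U U≈V kU = trans (e V U (λ y → sym (U≈V y (λ ())))) kU
  ∃-intro {k} e (x ∷ X) V U U≈V kU = branch (U x) refl
    where
    agrees : ∀ v → U x ≡ v → AgreeOff X U (V [ x ≔ v ])
    agrees v Ux≡v y y∉ with x ≟ y
    ... | yes refl = Ux≡v
    ... | no x≢y = U≈V y (λ { (here e) → x≢y (sym e) ; (there m) → y∉ m })
    branch : ∀ v → U x ≡ v → evalQ ex X (V [ x ≔ true ]) k ∨ evalQ ex X (V [ x ≔ false ]) k ≡ true
    branch true  Ux≡v rewrite ∃-intro e X _ U (agrees true Ux≡v) kU = refl
    branch false Ux≡v rewrite ∃-intro e X _ U (agrees false Ux≡v) kU = ∨-zeroʳ _

  ∀≡¬∃¬ : ∀ X V k → evalQ all X V k ≡ not (evalQ ex X V (λ U → not (k U)))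
  ∀≡¬∃¬ []      V k = sym (not-involutive (k V))
  ∀≡¬∃¬ (x ∷ X) V k rewrite ∀≡¬∃¬ X (V [ x ≔ true ]) k | ∀≡¬∃¬ X (V [ x ≔ false ]) k =
    de-morgan (evalQ ex X (V [ x ≔ true ]) _) (evalQ ex X (V [ x ≔ false ]) _)
    where
    de-morgan : ∀ a b → not a ∧ not b ≡ not (a ∨ b)
    de-morgan false b = refl
    de-morgan true  b = refl

  ∃-false : ∀ {k} → Extensional k → ∀ X V U → AgreeOff X U V → evalQ ex X V k ≡ false → k U ≡ false
  ∃-false e X V U U≈V ∃≡false =
    ¬-not {y = true} λ kU≡true → not-≢-self false (trans (sym (∃-intro e X V U U≈V kU≡true)) ∃≡false)

  ∀-elim : ∀ {k} → Extensional k → ∀ X V U → AgreeOff X U V → evalQ all X V k ≡ true → k U ≡ true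
  ∀-elim {k} e X V U U≈V ∀≡true = ¬-not {y = false} λ kU≡false → not-≢-self false
    (trans (sym ∀≡true)
           (trans (∀≡¬∃¬ X V k) (cong not (∃-intro (Extensional-not e) X V U U≈V (cong not kU≡false)))))

  ∀-intro : ∀ {k} X V → (∀ U → AgreeOff X U V → k U ≡ true) → evalQ all X V k ≡ true
  ∀-intro {k} X V h =
    trans (∀≡¬∃¬ X V k)
          (trans (cong not (sym (witness-value X V _))) (trans (not-involutive _) (h _ (witness-agrees X V _))))

  evalQ-dedup : ∀ {k} → Extensional k → ∀ q X V → evalQ q (dedup X) V k ≡ evalQ q X V k
  evalQ-dedup {k} e ex X V = ≡-from-truth
    (λ h → let (U , U≈V , kU) = ∃-elim (dedup X) V h
           in ∃-intro e X V U (λ y y∉ → U≈V y (λ m → y∉ (Equivalence.from (deduplicate-∈⇔ _≟_) m))) kU)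
    (λ h → let (U , U≈V , kU) = ∃-elim X V h
           in ∃-intro e (dedup X) V U (λ y y∉ → U≈V y (λ m → y∉ (Equivalence.to (deduplicate-∈⇔ _≟_) m))) kU)
  evalQ-dedup {k} e all X V = begin
    evalQ all (dedup X) V k                        ≡⟨ ∀≡¬∃¬ (dedup X) V k ⟩
    not (evalQ ex (dedup X) V (λ U → not (k U)))   ≡⟨ cong not (evalQ-dedup (Extensional-not e) ex X V) ⟩
    not (evalQ ex X V (λ U → not (k U)))           ≡⟨ sym (∀≡¬∃¬ X V k) ⟩
    evalQ all X V k                                ∎
    where open ≡-Reasoning

  -- Relevance and renaming

  AgreeBelow : ℕ → Valuation → Valuation → Set
  AgreeBelow n V W = ∀ y → y < n → V y ≡ W y

  boundList : List ℕ → ℕ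
  boundList = foldr (λ x m → suc x ⊔ m) 0

  ∈⇒<boundList : ∀ {x} X → x ∈ X → x < boundList X
  ∈⇒<boundList (x ∷ X) (here refl) = m<n⇒m<n⊔o (boundList X) ≤-refl
  ∈⇒<boundList (x ∷ X) (there x∈) = m<n⇒m<o⊔n (suc x) (∈⇒<boundList X x∈)

  mutual
    eval-cong-below : ∀ φ V W → AgreeBelow (bound φ) V W → eval V φ ≡ eval W φ
    eval-cong-below (var x)    V W h = h x ≤-refl
    eval-cong-below (op o as)  V W h = cong ⟦ o ⟧ (evalVec-cong-below as V W h)
    eval-cong-below (qb q X φ) V W h =
      evalQ-simulation (λ _ → AgreeBelow (bound φ)) (λ x _ U U' v r y y< → ≔-cong U U' x v y (λ _ → r y y<))
        (eval-cong-below φ) q X V W (λ y y< → h y (m<n⇒m<o⊔n (boundList X) y<))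

    evalVec-cong-below : ∀ {k} (as : Vec Formula k) V W → AgreeBelow (boundVec as) V W → evalVec V as ≡ evalVec W as
    evalVec-cong-below []       V W h = refl
    evalVec-cong-below (a ∷ as) V W h =
      cong₂ _∷_ (eval-cong-below a V W (λ y y< → h y (m<n⇒m<n⊔o (boundVec as) y<)))
                (evalVec-cong-below as V W (λ y y< → h y (m<n⇒m<o⊔n (bound a) y<)))

  eval-extensional : ∀ φ → Extensional (λ V → eval V φ)
  eval-extensional φ V W V≗W = eval-cong-below φ V W (λ y _ → V≗W y)

  TargetsAbove : ℕ → List (ℕ × ℕ) → Set
  TargetsAbove B ρ = All (λ p → B ≤ proj₂ p) ρ

  targets-weaken : ∀ {B B'} ρ → B' ≤ B → TargetsAbove B ρ → TargetsAbove B' ρ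
  targets-weaken ρ B'≤B = All.map (≤-trans B'≤B)

  lookupRen-fixed-or-above : ∀ {B} ρ y → TargetsAbove B ρ → lookupRen ρ y ≡ y ⊎ B ≤ lookupRen ρ y
  lookupRen-fixed-or-above []            y t = inj₁ refl
  lookupRen-fixed-or-above ((x , z) ∷ ρ) y (B≤z ∷ t) with x ≟ y
  ... | yes _ = inj₂ B≤z
  ... | no _  = lookupRen-fixed-or-above ρ y t

  lookupRen-removeRen-∈ : ∀ X ρ y → y ∈ X → lookupRen (removeRen X ρ) y ≡ y
  lookupRen-removeRen-∈ X []            y y∈ = refl
  lookupRen-removeRen-∈ X ((x , z) ∷ ρ) y y∈ with x ∈? X
  ... | yes _ = lookupRen-removeRen-∈ X ρ y y∈
  ... | no x∉ with x ≟ y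
  ...   | yes refl = ⊥-elim (x∉ y∈)
  ...   | no _     = lookupRen-removeRen-∈ X ρ y y∈

  lookupRen-removeRen-∉ : ∀ X ρ y → y ∉ X → lookupRen (removeRen X ρ) y ≡ lookupRen ρ y
  lookupRen-removeRen-∉ X []            y y∉ = refl
  lookupRen-removeRen-∉ X ((x , z) ∷ ρ) y y∉ with x ∈? X
  ... | yes x∈ with x ≟ y
  ...   | yes refl = ⊥-elim (y∉ x∈)
  ...   | no _     = lookupRen-removeRen-∉ X ρ y y∉
  lookupRen-removeRen-∉ X ((x , z) ∷ ρ) y y∉ | no _ with x ≟ y
  ...   | yes _ = refl
  ...   | no _  = lookupRen-removeRen-∉ X ρ y y∉

  removeRen-targets : ∀ {B} X ρ → TargetsAbove B ρ → TargetsAbove B (removeRen X ρ)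
  removeRen-targets X []            t = []
  removeRen-targets X ((x , z) ∷ ρ) (B≤z ∷ t) with x ∈? X
  ... | yes _ = removeRen-targets X ρ t
  ... | no _  = B≤z ∷ removeRen-targets X ρ t

  -- Renaming into variables ≥ bound φ cannot capture, so it acts on the valuation.
  mutual
    eval-rename : ∀ φ ρ V → TargetsAbove (bound φ) ρ → eval V (rename ρ φ) ≡ eval (λ y → V (lookupRen ρ y)) φ
    eval-rename (var x)    ρ V t = refl
    eval-rename (op o as)  ρ V t = cong ⟦ o ⟧ (evalVec-rename as ρ V t)
    eval-rename (qb q X φ) ρ V t =
      evalQ-simulation Sim instantiate done q X V (λ y → V (lookupRen ρ y))
        ((λ _ z∈ → z∈) , λ y _ → (λ y∈ y∉ → ⊥-elim (y∉ y∈)) , λ _ → refl)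
      where
      ρ' = removeRen X ρ

      -- Y ⊆ X is the part of the block still to be instantiated
      Sim : List ℕ → Valuation → Valuation → Set
      Sim Y U U' = (∀ z → z ∈ Y → z ∈ X)
                 × (∀ y → y < bound φ → (y ∈ X → y ∉ Y → U y ≡ U' y)
                                      × (y ∉ X → U (lookupRen ρ y) ≡ U' y))

      instantiate : ∀ x Y U U' v → Sim (x ∷ Y) U U' → Sim Y (U [ x ≔ v ]) (U' [ x ≔ v ])
      instantiate x Y U U' v (Y⊆X , r) = (λ z z∈ → Y⊆X z (there z∈)) , λ y y< → inside y y< , outside y y<
        where
        x∈X : x ∈ X
        x∈X = Y⊆X x (here refl)
        inside : ∀ y → y < bound φ → y ∈ X → y ∉ Y → (U [ x ≔ v ]) y ≡ (U' [ x ≔ v ]) y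
        inside y y< y∈X y∉Y =
          ≔-cong U U' x v y (λ x≢y → proj₁ (r y y<) y∈X (λ { (here e) → x≢y (sym e) ; (there m) → y∉Y m }))
        outside : ∀ y → y < bound φ → y ∉ X → (U [ x ≔ v ]) (lookupRen ρ y) ≡ (U' [ x ≔ v ]) y
        outside y y< y∉X with lookupRen-fixed-or-above ρ y t
        ... | inj₁ fixed rewrite fixed =
          ≔-cong U U' x v y (λ _ → subst (λ z → U z ≡ U' y) fixed (proj₂ (r y y<) y∉X))
        ... | inj₂ above =
          trans (≔-other U x v _ (λ e → <⇒≢ (<-≤-trans (m<n⇒m<n⊔o (bound φ) (∈⇒<boundList X x∈X)) above) e))
                (trans (proj₂ (r y y<) y∉X) (sym (≔-other U' x v y (λ e → y∉X (subst (_∈ X) e x∈X)))))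

      done : ∀ U U' → Sim [] U U' → eval U (rename ρ' φ) ≡ eval U' φ
      done U U' (_ , r) =
        trans (eval-rename φ ρ' U (removeRen-targets X ρ (targets-weaken ρ (m≤n⊔m (boundList X) (bound φ)) t)))
              (eval-cong-below φ _ U' read)
        where
        read : ∀ y → y < bound φ → U (lookupRen ρ' y) ≡ U' y
        read y y< with y ∈? X
        ... | yes y∈ = trans (cong U (lookupRen-removeRen-∈ X ρ y y∈)) (proj₁ (r y y<) y∈ (λ ()))
        ... | no y∉  = trans (cong U (lookupRen-removeRen-∉ X ρ y y∉)) (proj₂ (r y y<) y∉)

    evalVec-rename : ∀ {k} (as : Vec Formula k) ρ V → TargetsAbove (boundVec as) ρ →
                     evalVec V (renameVec ρ as) ≡ evalVec (λ y → V (lookupRen ρ y)) as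
    evalVec-rename []       ρ V t = refl
    evalVec-rename (a ∷ as) ρ V t =
      cong₂ _∷_ (eval-rename a ρ V (targets-weaken ρ (m≤m⊔n (bound a) (boundVec as)) t))
                (evalVec-rename as ρ V (targets-weaken ρ (m≤n⊔m (bound a) (boundVec as)) t))

  lookupRen-zip-∈ : ∀ X a x → x ∈ X →
    ∃ λ j → j < length X × lookupRen (zip X (range a (length X))) x ≡ a + j × nth X j ≡ x
  lookupRen-zip-∈ (x' ∷ X) a x x∈ with x' ≟ x
  ... | yes x'≡x = 0 , s≤s z≤n , sym (+-identityʳ a) , x'≡x
  ... | no x'≢x with x∈
  ...   | here e = ⊥-elim (x'≢x (sym e))
  ...   | there x∈X with lookupRen-zip-∈ X (suc a) x x∈X
  ...     | j , j< , lookup≡ , nth≡ = suc j , s≤s j< , trans lookup≡ (sym (+-suc a j)) , nth≡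

  lookupRen-zip-∉ : ∀ X L x → x ∉ X → lookupRen (zip X L) x ≡ x
  lookupRen-zip-∉ []       L       x x∉ = refl
  lookupRen-zip-∉ (x' ∷ X) []      x x∉ = refl
  lookupRen-zip-∉ (x' ∷ X) (t ∷ L) x x∉ with x' ≟ x
  ... | yes e = ⊥-elim (x∉ (here (sym e)))
  ... | no _  = lookupRen-zip-∉ X L x (λ x∈ → x∉ (there x∈))

  zip-targets : ∀ {B} X L → All (B ≤_) L → TargetsAbove B (zip X L)
  zip-targets []      L       _          = []
  zip-targets (x ∷ X) []      _          = []
  zip-targets (x ∷ X) (t ∷ L) (B≤t ∷ ts) = B≤t ∷ zip-targets X L ts

  ⊨⊤ : ∀ W → W ⊨ ⊤f
  ⊨⊤ W = trans (neg-sem _) (cong not bot-sem)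

  ⊨-∧⁻ : ∀ W a b → W ⊨ (a ∧f b) → W ⊨ a × W ⊨ b
  ⊨-∧⁻ W a b h = let h' = trans (sym (conj-sem _ _)) h in ∧-conicalˡ _ _ h' , ∧-conicalʳ _ _ h'

  ⊨-∧⁺ : ∀ W a b → W ⊨ a → W ⊨ b → W ⊨ (a ∧f b)
  ⊨-∧⁺ W a b ha hb = trans (conj-sem _ _) (∧-intro ha hb)

  ⊨-⇒⁻ : ∀ W a b → W ⊨ (a ⇒f b) → W ⊨ a → W ⊨ b
  ⊨-⇒⁻ W a b h = not-∨-elim (trans (sym (impl-sem _ _)) h)

  ⊨-⇒⁺ : ∀ W a b → (W ⊨ a → W ⊨ b) → W ⊨ (a ⇒f b)
  ⊨-⇒⁺ W a b h = trans (impl-sem _ _) (not-∨-intro h)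

  ⊨-⇔⁻ : ∀ W a b → W ⊨ (a ⇔f b) → eval W a ≡ eval W b
  ⊨-⇔⁻ W a b h = not-xor≡true⇒≡ (trans (sym (biimp-sem _ _)) h)

  ⊨-⇔⁺ : ∀ W a b → eval W a ≡ eval W b → W ⊨ (a ⇔f b)
  ⊨-⇔⁺ W a b h = trans (biimp-sem _ _) (≡⇒not-xor≡true h)

  ⊨-⋀⁻ : ∀ W L → W ⊨ ⋀ L → All (W ⊨_) L
  ⊨-⋀⁻ W []           h = []
  ⊨-⋀⁻ W (a ∷ [])     h = h ∷ []
  ⊨-⋀⁻ W (a ∷ b ∷ L)  h = let (ha , hL) = ⊨-∧⁻ W a (⋀ (b ∷ L)) h in ha ∷ ⊨-⋀⁻ W (b ∷ L) hL

  ⊨-⋀⁺ : ∀ W L → All (W ⊨_) L → W ⊨ ⋀ L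
  ⊨-⋀⁺ W []          _          = ⊨⊤ W
  ⊨-⋀⁺ W (a ∷ [])    (ha ∷ [])  = ha
  ⊨-⋀⁺ W (a ∷ b ∷ L) (ha ∷ hL)  = ⊨-∧⁺ W a (⋀ (b ∷ L)) ha (⊨-⋀⁺ W (b ∷ L) hL)

  equivalences : List ℕ → List ℕ → List Formula
  equivalences = zipWith (λ x y → var x ⇔f var y)

  ⊨-equivalences⁻ : ∀ W a b n → All (W ⊨_) (equivalences (range a n) (range b n)) →
                    ∀ j → j < n → W (a + j) ≡ W (b + j)
  ⊨-equivalences⁻ W a b (suc n) (h ∷ _) zero _ rewrite +-identityʳ a | +-identityʳ b = ⊨-⇔⁻ W (var a) (var b) h
  ⊨-equivalences⁻ W a b (suc n) (_ ∷ hs) (suc j) (s≤s j<) rewrite +-suc a j | +-suc b j =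
    ⊨-equivalences⁻ W (suc a) (suc b) n hs j j<

  ⊨-equivalences⁺ : ∀ W a b n → (∀ j → j < n → W (a + j) ≡ W (b + j)) →
                    All (W ⊨_) (equivalences (range a n) (range b n))
  ⊨-equivalences⁺ W a b zero    h = []
  ⊨-equivalences⁺ W a b (suc n) h =
    ⊨-⇔⁺ W (var a) (var b) (subst₂ (λ u v → W u ≡ W v) (+-identityʳ a) (+-identityʳ b) (h 0 (s≤s z≤n)))
    ∷ ⊨-equivalences⁺ W (suc a) (suc b) n
        (λ j j< → subst₂ (λ u v → W u ≡ W v) (+-suc a j) (+-suc b j) (h (suc j) (s≤s j<)))

  -- Decomposition

  mutual
    quantSize : Formula → ℕ
    quantSize (var x)    = 0
    quantSize (op o as)  = quantSizeVec as
    quantSize (qb q X φ) = suc (length (dedup X) + quantSize φ)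

    quantSizeVec : ∀ {k} → Vec Formula k → ℕ
    quantSizeVec []       = 0
    quantSizeVec (a ∷ as) = quantSize a + quantSizeVec as

  sum-map-++ : ∀ (f : Item → ℕ) its its' → sum (map f (its ++ its')) ≡ sum (map f its) + sum (map f its')
  sum-map-++ f its its' = trans (cong sum (map-++ f its its')) (sum-++ (map f its) (map f its'))

  varCount bodySize bodyQuantSize : List Item → ℕ
  varCount      its = sum (map (λ it → length (vars it)) its)
  bodySize      its = sum (map (λ it → size (body it)) its)
  bodyQuantSize its = sum (map (λ it → quantSize (body it)) its)

  quantified : Item → Formula
  quantified it = qb (quant it) (vars it) (body it)

  itemValue : Valuation → Item → Bool
  itemValue V it = eval V (quantified it)

  quantDepth bodyDepth : List Item → ℕ
  quantDepth = foldr (λ it m → depth (quantified it) ⊔ m) 0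
  bodyDepth  = foldr (λ it m → depth (body it) ⊔ m) 0

  quantDepth-++ : ∀ its its' → quantDepth (its ++ its') ≡ quantDepth its ⊔ quantDepth its'
  quantDepth-++ []         its' = refl
  quantDepth-++ (it ∷ its) its' rewrite quantDepth-++ its its' =
    sym (⊔-assoc (depth (quantified it)) (quantDepth its) (quantDepth its'))

  quantDepth-∷ : ∀ it its → quantDepth (it ∷ its) ≡ suc (bodyDepth (it ∷ its))
  quantDepth-∷ it [] rewrite ⊔-identityʳ (suc (depth (body it))) | ⊔-identityʳ (depth (body it)) = refl
  quantDepth-∷ it (it' ∷ its) rewrite quantDepth-∷ it' its = refl

  itemAt : Quant → ℕ → List ℕ → Formula → Item
  itemAt q c X φ = item q c X φ (block (suc c) (length X)) (block (suc c + length X) (length X))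

  -- An item at c takes p = c, then its plus and its minus copies; the next item starts after them.
  data Layout (B : ℕ) : ℕ → List Item → ℕ → Set where
    []   : ∀ {c} → Layout B c [] c
    cons : ∀ {c q X φ its c'} → bound φ ≤ B → B ≤ c →
           Layout B (suc c + length X + length X) its c' → Layout B c (itemAt q c X φ ∷ its) c'

  Layout-++ : ∀ {B c its c' its' c''} → Layout B c its c' → Layout B c' its' c'' → Layout B c (its ++ its') c''
  Layout-++ []                 l' = l'
  Layout-++ (cons φB B≤c l) l' = cons φB B≤c (Layout-++ l l')

  item-width : ∀ c n → c < suc c + n + n
  item-width c n = s≤s (≤-trans (m≤m+n c n) (m≤m+n (c + n) n))

  Layout-≤ : ∀ {B c its c'} → Layout B c its c' → c ≤ c'
  Layout-≤ []                              = ≤-refl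
  Layout-≤ {c = c} (cons {X = X} _ _ l) = ≤-trans (<⇒≤ (item-width c (length X))) (Layout-≤ l)

  record IsDecomposition (B c : ℕ) (φ β : Formula) (its : List Item) (c' : ℕ) : Set where
    field
      layout          : Layout B c its c'
      β-boolean       : Boolean β
      no-items⇒boolean : its ≡ [] → Boolean φ
      boolean⇒no-items : Boolean φ → its ≡ []
      depth-≡         : depth φ ≡ quantDepth its
      size-≡          : size φ ≡ size β + (varCount its + bodySize its)
      quantSize-≡     : quantSize φ ≡ length its + varCount its + bodyQuantSize its
      eval-≡          : ∀ V W → AgreeBelow (bound φ) W V → All (λ it → W (pvar it) ≡ itemValue V it) its →
                        eval W β ≡ eval V φ

  record IsDecompositionVec {k} (B c : ℕ) (as bs : Vec Formula k) (its : List Item) (c' : ℕ) : Set where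
    field
      layout          : Layout B c its c'
      β-boolean       : isBoolVec bs ≡ true
      no-items⇒boolean : its ≡ [] → isBoolVec as ≡ true
      boolean⇒no-items : isBoolVec as ≡ true → its ≡ []
      depth-≡         : depthVec as ≡ quantDepth its
      size-≡          : sizeVec as ≡ sizeVec bs + (varCount its + bodySize its)
      quantSize-≡     : quantSizeVec as ≡ length its + varCount its + bodyQuantSize its
      eval-≡          : ∀ V W → AgreeBelow (boundVec as) W V → All (λ it → W (pvar it) ≡ itemValue V it) its →
                        evalVec W bs ≡ evalVec V as

  mutual
    decomp-correct : ∀ B c φ → bound φ ≤ B → B ≤ c →
      let (β , its , c') = decomp c φ in IsDecomposition B c φ β its c'
    decomp-correct B c (var x) φB B≤c = record
      { layout = [] ; β-boolean = refl ; no-items⇒boolean = λ _ → refl ; boolean⇒no-items = λ _ → refl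
      ; depth-≡ = refl ; size-≡ = refl ; quantSize-≡ = refl ; eval-≡ = λ V W W≈V _ → W≈V x ≤-refl }
    decomp-correct B c (op o as) asB B≤c with decompVec c as | decompVec-correct B c as asB B≤c
    ... | bs , its , c' | d = record
      { layout = layout ; β-boolean = β-boolean ; no-items⇒boolean = no-items⇒boolean
      ; boolean⇒no-items = boolean⇒no-items ; depth-≡ = depth-≡ ; size-≡ = cong suc size-≡
      ; quantSize-≡ = quantSize-≡ ; eval-≡ = λ V W W≈V ps → cong ⟦ o ⟧ (eval-≡ V W W≈V ps) }
      where open IsDecompositionVec d
    decomp-correct B c (qb q X φ) qφB B≤c = record
      { layout = cons (≤-trans (m≤n⊔m (boundList X) (bound φ)) qφB) B≤c []
      ; β-boolean = refl ; no-items⇒boolean = λ () ; boolean⇒no-items = λ ()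
      ; depth-≡ = sym (⊔-identityʳ _) ; size-≡ = cong suc (pad (size φ)) ; quantSize-≡ = cong suc (pad (quantSize φ))
      ; eval-≡ = λ { V W _ (Wc≡ ∷ []) → trans Wc≡ (evalQ-dedup (eval-extensional φ) q X V) } }
      where
      pad : ∀ n → length (dedup X) + n ≡ (length (dedup X) + 0) + (n + 0)
      pad n = sym (cong₂ _+_ (+-identityʳ (length (dedup X))) (+-identityʳ n))

    decompVec-correct : ∀ {k} B c (as : Vec Formula k) → boundVec as ≤ B → B ≤ c →
      let (bs , its , c') = decompVec c as in IsDecompositionVec B c as bs its c'
    decompVec-correct B c [] _ _ = record
      { layout = [] ; β-boolean = refl ; no-items⇒boolean = λ _ → refl ; boolean⇒no-items = λ _ → refl
      ; depth-≡ = refl ; size-≡ = refl ; quantSize-≡ = refl ; eval-≡ = λ _ _ _ _ → refl }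
    decompVec-correct B c (a ∷ as) aasB B≤c
      with decomp c a | decomp-correct B c a (m⊔n≤o⇒m≤o (bound a) _ aasB) B≤c
    ... | b , its , c' | d
      with decompVec c' as | decompVec-correct B c' as (m⊔n≤o⇒n≤o (bound a) _ aasB)
                                (≤-trans B≤c (Layout-≤ (IsDecomposition.layout d)))
    ... | bs , its' , c'' | ds = record
      { layout = Layout-++ D.layout Ds.layout
      ; β-boolean = ∧-intro D.β-boolean Ds.β-boolean
      ; no-items⇒boolean = λ e → ∧-intro (D.no-items⇒boolean (++-conicalˡ its its' e))
                                         (Ds.no-items⇒boolean (++-conicalʳ its its' e))
      ; boolean⇒no-items = λ e → cong₂ _++_ (D.boolean⇒no-items (∧-conicalˡ _ _ e))
                                            (Ds.boolean⇒no-items (∧-conicalʳ _ _ e))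
      ; depth-≡ = trans (cong₂ _⊔_ D.depth-≡ Ds.depth-≡) (sym (quantDepth-++ its its'))
      ; size-≡ = trans (cong₂ _+_ D.size-≡ Ds.size-≡)
                       (trans (regroup (size b) (varCount its) (bodySize its) (sizeVec bs) (varCount its') (bodySize its'))
                              (sym (cong₂ (λ v s → size b + sizeVec bs + (v + s))
                                          (sum-map-++ _ its its') (sum-map-++ _ its its'))))
      ; quantSize-≡ = trans (cong₂ _+_ D.quantSize-≡ Ds.quantSize-≡)
                            (trans (regroup' (length its) (varCount its) (bodyQuantSize its)
                                             (length its') (varCount its') (bodyQuantSize its'))
                                   (sym (cong₂ _+_ (cong₂ _+_ (length-++ its) (sum-map-++ _ its its'))
                                                   (sum-map-++ _ its its'))))
      ; eval-≡ = λ V W W≈V ps →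
          cong₂ _∷_ (D.eval-≡ V W (λ y y< → W≈V y (m<n⇒m<n⊔o (boundVec as) y<)) (All.++⁻ˡ its ps))
                    (Ds.eval-≡ V W (λ y y< → W≈V y (m<n⇒m<o⊔n (bound a) y<)) (All.++⁻ʳ its ps)) }
      where
      module D = IsDecomposition d
      module Ds = IsDecompositionVec ds
      regroup : ∀ b v s bs v' s' → (b + (v + s)) + (bs + (v' + s')) ≡ b + bs + ((v + v') + (s + s'))
      regroup = solve-∀
      regroup' : ∀ l v q l' v' q' → (l + v + q) + (l' + v' + q') ≡ (l + l') + (v + v') + (q + q')
      regroup' = solve-∀

  step-correct : ∀ b φ →
    ∃ λ c' → IsDecomposition (bound φ) (b ⊔ bound φ) φ (beta (step b φ)) (items (step b φ)) c'
  step-correct b φ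
    with decomp (b ⊔ bound φ) φ | decomp-correct (bound φ) (b ⊔ bound φ) φ ≤-refl (m≤n⊔m b (bound φ))
  ... | _ , _ , c' | d = c' , d

  -- A single quantified subformula

  -- When Q X φ takes the value uniform q, the body φ is constant on the block; that is when the
  -- guard of p forces x⁺ = x⁻.
  uniform : Quant → Bool
  uniform ex  = false
  uniform all = true

  sought : Quant → Formula → Valuation → Bool
  sought ex  φ U = eval U φ
  sought all φ U = not (eval U φ)

  blockWitness : Valuation → Item → Valuation
  blockWitness V it = witness (vars it) V (sought (quant it) (body it))

  blockWitness-value : ∀ V it → eval (blockWitness V it) (body it) ≡ itemValue V it
  blockWitness-value V (item ex  _ X φ _ _) = witness-value X V (sought ex φ)
  blockWitness-value V (item all _ X φ _ _) =
    trans (sym (not-involutive _))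
          (trans (cong not (witness-value X V (sought all φ))) (sym (∀≡¬∃¬ X V (λ U → eval U φ))))

  blockWitness-agrees : ∀ V it → AgreeOff (vars it) (blockWitness V it) V
  blockWitness-agrees V it = witness-agrees (vars it) V _

  uniform-body : ∀ V it → itemValue V it ≡ uniform (quant it) →
                 ∀ U → AgreeOff (vars it) U V → eval U (body it) ≡ uniform (quant it)
  uniform-body V (item ex  _ X φ _ _) h U U≈V = ∃-false (eval-extensional φ) X V U U≈V h
  uniform-body V (item all _ X φ _ _) h U U≈V = ∀-elim (eval-extensional φ) X V U U≈V h

  non-uniform-body : ∀ V it U → AgreeOff (vars it) U V → eval U (body it) ≡ not (uniform (quant it)) →
                     itemValue V it ≡ not (uniform (quant it))
  non-uniform-body V it U U≈V h with ≡-or-≡not (itemValue V it) (uniform (quant it))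
  ... | inj₂ non = non
  ... | inj₁ uni = ⊥-elim (not-≢-self _ (trans (sym h) (uniform-body V it uni U U≈V)))

  GuardHolds : Valuation → Item → Set
  GuardHolds W it = W (pvar it) ≡ uniform (quant it) → W ⊨ eqs it

  ItemConstraints : Valuation → Item → Set
  ItemConstraints W it = (W (pvar it) ≡ eval W (rename (σ it) (body it))) × GuardHolds W it

  module ItemSemantics {B c : ℕ} (q : Quant) (X : List ℕ) (φ : Formula) (φB : bound φ ≤ B) (B≤c : B ≤ c) where
    private
      n  = length X
      it = itemAt q c X φ

    readBlock : Valuation → Valuation → Valuation
    readBlock V W y with y ∈? X
    ... | yes _ = W (lookupRen (σ it) y)
    ... | no _  = V y

    readBlock-agrees : ∀ V W → AgreeOff X (readBlock V W) V
    readBlock-agrees V W y y∉ with y ∈? X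
    ... | yes y∈ = ⊥-elim (y∉ y∈)
    ... | no _   = refl

    readBlock-≗ : ∀ V W S' → AgreeOff X S' V → (∀ j → j < n → W (suc c + j) ≡ S' (nth X j)) →
                  readBlock V W ≗ S'
    readBlock-≗ V W S' S'≈V plus≡ y with y ∈? X
    ... | no y∉ = sym (S'≈V y y∉)
    ... | yes y∈ with lookupRen-zip-∈ X (suc c) y y∈
    ...   | j , j< , lookup≡ , nth≡ =
      trans (cong W (trans (cong (λ L → lookupRen (zip X L) y) (block≡range (suc c) n)) lookup≡))
            (trans (plus≡ j j<) (cong S' nth≡))

    eval-renamed-body : ∀ V W → AgreeBelow B W V → eval W (rename (σ it) φ) ≡ eval (readBlock V W) φ
    eval-renamed-body V W W≈V =
      trans (eval-rename φ (σ it) W (zip-targets X (block (suc c) n) (All.tabulate above)))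
            (eval-cong-below φ _ _ read)
      where
      above : ∀ {t} → t ∈ block (suc c) n → bound φ ≤ t
      above t∈ = ≤-trans φB (≤-trans B≤c (<⇒≤ (proj₁ (∈-block⁻ (suc c) n t∈))))
      read : ∀ y → y < bound φ → W (lookupRen (σ it) y) ≡ readBlock V W y
      read y y< with y ∈? X
      ... | yes _ = refl
      ... | no y∉ = trans (cong W (lookupRen-zip-∉ X _ y y∉)) (W≈V y (<-≤-trans y< φB))

    ⊨eqs⁻ : ∀ W → W ⊨ eqs it → ∀ j → j < n → W (suc c + j) ≡ W (suc c + n + j)
    ⊨eqs⁻ W h = ⊨-equivalences⁻ W (suc c) (suc c + n) n
      (subst₂ (λ L M → All (W ⊨_) (equivalences L M)) (block≡range (suc c) n) (block≡range (suc c + n) n)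
              (⊨-⋀⁻ W _ h))

    ⊨eqs⁺ : ∀ W → (∀ j → j < n → W (suc c + j) ≡ W (suc c + n + j)) → W ⊨ eqs it
    ⊨eqs⁺ W h = ⊨-⋀⁺ W _
      (subst₂ (λ L M → All (W ⊨_) (equivalences L M)) (sym (block≡range (suc c) n)) (sym (block≡range (suc c + n) n))
              (⊨-equivalences⁺ W (suc c) (suc c + n) n h))

    pvar-determined : ∀ V W → AgreeBelow B W V → ItemConstraints W it →
                      (∀ j → j < n → W (suc c + n + j) ≡ blockWitness V it (nth X j)) → W c ≡ itemValue V it
    pvar-determined V W W≈V (def , guard) minus≡ with ≡-or-≡not (W c) (uniform q)
    ... | inj₁ uni = begin
      W c                                 ≡⟨ def ⟩
      eval W (rename (σ it) φ)             ≡⟨ eval-renamed-body V W W≈V ⟩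
      eval (readBlock V W) φ
        ≡⟨ eval-extensional φ _ _ (readBlock-≗ V W _ (blockWitness-agrees V it) plus≡) ⟩
      eval (blockWitness V it) φ           ≡⟨ blockWitness-value V it ⟩
      itemValue V it                       ∎
      where
      open ≡-Reasoning
      plus≡ : ∀ j → j < n → W (suc c + j) ≡ blockWitness V it (nth X j)
      plus≡ j j< = trans (⊨eqs⁻ W (guard uni) j j<) (minus≡ j j<)
    ... | inj₂ non = trans non (sym (non-uniform-body V it (readBlock V W) (readBlock-agrees V W)
                                      (trans (sym (eval-renamed-body V W W≈V)) (trans (sym def) non))))

    constraints-hold : ∀ V W → AgreeBelow B W V → W c ≡ itemValue V it →
      (itemValue V it ≡ uniform q → ∀ j → j < n → W (suc c + j) ≡ W (suc c + n + j)) →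
      (itemValue V it ≡ not (uniform q) → ∀ j → j < n → W (suc c + j) ≡ blockWitness V it (nth X j)) →
      ItemConstraints W it
    constraints-hold V W W≈V Wc≡ copies witnesses = def , λ uni → ⊨eqs⁺ W (copies (trans (sym Wc≡) uni))
      where
      def : W c ≡ eval W (rename (σ it) φ)
      def with ≡-or-≡not (itemValue V it) (uniform q)
      ... | inj₁ uni = trans Wc≡ (trans uni (sym (trans (eval-renamed-body V W W≈V)
                         (uniform-body V it uni (readBlock V W) (readBlock-agrees V W)))))
      ... | inj₂ non = trans Wc≡ (sym (trans (eval-renamed-body V W W≈V)
                         (trans (eval-extensional φ _ _ (readBlock-≗ V W _ (blockWitness-agrees V it) (witnesses non)))
                                (blockWitness-value V it))))

  guards⁻ : ∀ W its → All (W ⊨_) (exGuards its) → All (W ⊨_) (allGuards its) → All (GuardHolds W) its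
  guards⁻ W [] _ _ = []
  guards⁻ W (it@(item ex p _ _ _ _) ∷ its) (g ∷ gs) hs =
    (λ p≡false → ⊨-⇒⁻ W (¬f (var p)) (eqs it) g (trans (neg-sem _) (cong not p≡false))) ∷ guards⁻ W its gs hs
  guards⁻ W (it@(item all p _ _ _ _) ∷ its) gs (h ∷ hs) =
    ⊨-⇒⁻ W (var p) (eqs it) h ∷ guards⁻ W its gs hs

  guards⁺ : ∀ W its → All (GuardHolds W) its → All (W ⊨_) (exGuards its) × All (W ⊨_) (allGuards its)
  guards⁺ W [] _ = [] , []
  guards⁺ W (it@(item ex p _ _ _ _) ∷ its) (g ∷ gs) =
    let (es , as) = guards⁺ W its gs
    in ⊨-⇒⁺ W (¬f (var p)) (eqs it) (λ ⊨¬p → g (¬-not {y = true} λ p≡true →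
         not-≢-self false (trans (sym ⊨¬p) (trans (neg-sem _) (cong not p≡true)))))
       ∷ es , as
  guards⁺ W (it@(item all p _ _ _ _) ∷ its) (g ∷ gs) =
    let (es , as) = guards⁺ W its gs in es , ⊨-⇒⁺ W (var p) (eqs it) g ∷ as

  ⊨A⇒constraints : ∀ W r → W ⊨ A r → All (ItemConstraints W) (items r)
  ⊨A⇒constraints W r h =
    let (hd , hg) = ⊨-∧⁻ W (⋀ (defs its)) (⋀ (exGuards its) ∧f ⋀ (allGuards its)) h
        (he , ha) = ⊨-∧⁻ W (⋀ (exGuards its)) (⋀ (allGuards its)) hg
    in All.zip (definitions its (⊨-⋀⁻ W _ hd) , guards⁻ W its (⊨-⋀⁻ W _ he) (⊨-⋀⁻ W _ ha))
    where
    its = items r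
    definitions : ∀ its → All (W ⊨_) (defs its) → All (λ it → W (pvar it) ≡ eval W (rename (σ it) (body it))) its
    definitions []         []       = []
    definitions (it ∷ its) (d ∷ ds) = ⊨-⇔⁻ W (var (pvar it)) (rename (σ it) (body it)) d ∷ definitions its ds

  constraints⇒⊨A : ∀ W r → All (ItemConstraints W) (items r) → W ⊨ A r
  constraints⇒⊨A W r cs =
    let (es , as) = guards⁺ W its (All.map proj₂ cs)
    in ⊨-∧⁺ W (⋀ (defs its)) (⋀ (exGuards its) ∧f ⋀ (allGuards its))
             (⊨-⋀⁺ W _ (definitions its (All.map proj₁ cs)))
             (⊨-∧⁺ W (⋀ (exGuards its)) (⋀ (allGuards its)) (⊨-⋀⁺ W _ es) (⊨-⋀⁺ W _ as))
    where
    its = items r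
    definitions : ∀ its → All (λ it → W (pvar it) ≡ eval W (rename (σ it) (body it))) its → All (W ⊨_) (defs its)
    definitions []         []       = []
    definitions (it ∷ its) (d ∷ ds) = ⊨-⇔⁺ W (var (pvar it)) (rename (σ it) (body it)) d ∷ definitions its ds

  -- Valuations realising the quantifier prefixes

  pVars nVars : List Item → List ℕ
  pVars its = map pvar its ++ concatMap plus its
  nVars its = concatMap minus its

  plusVar minusVar : Item → ℕ → ℕ
  plusVar  it j = suc (pvar it) + j
  minusVar it j = suc (pvar it) + length (vars it) + j

  pvar≤plusVar : ∀ it j → pvar it ≤ plusVar it j
  pvar≤plusVar it j = ≤-trans (n≤1+n (pvar it)) (m≤m+n _ j)

  pvar<minusVar : ∀ it j → pvar it < minusVar it j
  pvar<minusVar it j = s≤s (≤-trans (m≤m+n (pvar it) (length (vars it))) (m≤m+n _ j))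

  ∈-pVars-∷⁻ : ∀ it its {y} → y ∈ pVars (it ∷ its) → y ≡ pvar it ⊎ y ∈ plus it ⊎ y ∈ pVars its
  ∈-pVars-∷⁻ it its (here e) = inj₁ e
  ∈-pVars-∷⁻ it its (there y∈) with ∈-++⁻ (map pvar its) y∈
  ... | inj₁ y∈p = inj₂ (inj₂ (∈-++⁺ˡ y∈p))
  ... | inj₂ y∈+ with ∈-++⁻ (plus it) y∈+
  ...   | inj₁ y∈plus = inj₂ (inj₁ y∈plus)
  ...   | inj₂ y∈rest = inj₂ (inj₂ (∈-++⁺ʳ (map pvar its) y∈rest))

  ∉-pVars-∷⁺ : ∀ it its {y} → y ≢ pvar it → y ∉ plus it → y ∉ pVars its → y ∉ pVars (it ∷ its)
  ∉-pVars-∷⁺ it its y≢p y∉plus y∉rest y∈ with ∈-pVars-∷⁻ it its y∈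
  ... | inj₁ e               = y≢p e
  ... | inj₂ (inj₁ y∈plus)   = y∉plus y∈plus
  ... | inj₂ (inj₂ y∈rest)   = y∉rest y∈rest

  ∉-pVars-∷⁻ : ∀ it its {y} → y ∉ pVars (it ∷ its) → y ≢ pvar it × y ∉ plus it × y ∉ pVars its
  ∉-pVars-∷⁻ it its y∉ =
      (λ e → y∉ (here e))
    , (λ y∈ → y∉ (there (∈-++⁺ʳ (map pvar its) (∈-++⁺ˡ y∈))))
    , rest
    where
    rest : _ ∉ pVars its
    rest y∈ with ∈-++⁻ (map pvar its) y∈
    ... | inj₁ y∈p    = y∉ (there (∈-++⁺ˡ y∈p))
    ... | inj₂ y∈plus = y∉ (there (∈-++⁺ʳ (map pvar its) (∈-++⁺ʳ (plus it) y∈plus)))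

  Layout-pvar-≥ : ∀ {B c its c'} → Layout B c its c' → All (λ it → c ≤ pvar it) its
  Layout-pvar-≥ []                             = []
  Layout-pvar-≥ {c = c} (cons {X = X} _ _ l) =
    ≤-refl ∷ All.map (≤-trans (<⇒≤ (item-width c (length X)))) (Layout-pvar-≥ l)

  pVars-≥ : ∀ {B c its c' y} → Layout B c its c' → y ∈ pVars its → c ≤ y
  pVars-≥ {c = c} {it ∷ its} (cons {X = X} _ _ l) y∈ with ∈-pVars-∷⁻ it its y∈
  ... | inj₁ refl          = ≤-refl
  ... | inj₂ (inj₁ y∈plus) = <⇒≤ (proj₁ (∈-block⁻ (suc c) (length X) y∈plus))
  ... | inj₂ (inj₂ y∈rest) = ≤-trans (<⇒≤ (item-width c (length X))) (pVars-≥ l y∈rest)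

  nVars-≥ : ∀ {B c its c' y} → Layout B c its c' → y ∈ nVars its → c ≤ y
  nVars-≥ {c = c} {it ∷ its} (cons {X = X} _ _ l) y∈ with ∈-++⁻ (minus it) y∈
  ... | inj₁ y∈minus = ≤-trans (≤-trans (n≤1+n c) (m≤m+n (suc c) (length X)))
                               (proj₁ (∈-block⁻ (suc c + length X) (length X) y∈minus))
  ... | inj₂ y∈rest  = ≤-trans (<⇒≤ (item-width c (length X))) (nVars-≥ l y∈rest)

  minus∉pVars : ∀ {B c its c'} → Layout B c its c' →
                All (λ it → ∀ j → j < length (vars it) → minusVar it j ∉ pVars its) its
  minus∉pVars [] = []
  minus∉pVars {c = c} {it ∷ its} (cons {X = X} _ _ l) =
    (λ j j< → ∉-pVars-∷⁺ it its (λ e → <⇒≢ (pvar<minusVar it j) (sym e))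
                (λ m∈ → <⇒≱ (proj₂ (∈-block⁻ (suc c) n m∈)) (m≤m+n (suc c + n) j))
                (λ m∈ → <⇒≱ (+-monoʳ-< (suc c + n) j<) (pVars-≥ l m∈)))
    ∷ All.zipWith (λ {it'} → later {it'}) (minus∉pVars l , Layout-pvar-≥ l)
    where
    n = length X
    later : ∀ {it'} → (∀ j → j < length (vars it') → minusVar it' j ∉ pVars its) × suc c + n + n ≤ pvar it' →
            ∀ j → j < length (vars it') → minusVar it' j ∉ pVars (it ∷ its)
    later {it'} (∉rest , c'≤p) j j< = ∉-pVars-∷⁺ it its
      (λ e → <⇒≢ (<-≤-trans (<-≤-trans (item-width c n) c'≤p) (<⇒≤ (pvar<minusVar it' j))) (sym e))
      (λ m∈ → <⇒≱ (proj₂ (∈-block⁻ (suc c) n m∈))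
                  (≤-trans (≤-trans (m≤m+n (suc c + n) n) c'≤p) (<⇒≤ (pvar<minusVar it' j))))
      (∉rest j j<)

  overwrite : ℕ → ℕ → (ℕ → Bool) → Valuation → Valuation
  overwrite a n f W y with a ≤? y | y <? a + n
  ... | yes _ | yes _ = f (y ∸ a)
  ... | _     | _     = W y

  overwrite-inside : ∀ a n f W j → j < n → overwrite a n f W (a + j) ≡ f j
  overwrite-inside a n f W j j< with a ≤? a + j | a + j <? a + n
  ... | yes _  | yes _  = cong f (m+n∸m≡n a j)
  ... | no a≰  | _      = ⊥-elim (a≰ (m≤m+n a j))
  ... | yes _  | no ≮   = ⊥-elim (≮ (+-monoʳ-< a j<))

  overwrite-outside : ∀ a n f W y → y < a ⊎ a + n ≤ y → overwrite a n f W y ≡ W y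
  overwrite-outside a n f W y out with a ≤? y | y <? a + n
  ... | yes a≤y | yes y< with out
  ...   | inj₁ y<a  = ⊥-elim (<⇒≱ y<a a≤y)
  ...   | inj₂ a+n≤ = ⊥-elim (<⇒≱ y< a+n≤)
  overwrite-outside a n f W y out | yes _ | no _ = refl
  overwrite-outside a n f W y out | no _  | _    = refl

  WitnessesAt : Valuation → Valuation → Item → Set
  WitnessesAt U V it = ∀ j → j < length (vars it) → U (minusVar it j) ≡ blockWitness V it (nth (vars it) j)

  withWitnesses : Valuation → List Item → Valuation
  withWitnesses V []         = V
  withWitnesses V (it ∷ its) =
    overwrite (suc (pvar it) + length (vars it)) (length (vars it)) (λ j → blockWitness V it (nth (vars it) j))
              (withWitnesses V its)

  withWitnesses-agrees : ∀ {B c its c'} V → Layout B c its c' → AgreeOff (nVars its) (withWitnesses V its) V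
  withWitnesses-agrees V [] y _ = refl
  withWitnesses-agrees {its = it ∷ its} V (cons {c = c} {X = X} _ _ l) y y∉ =
    trans (overwrite-outside _ _ _ _ y (∉-block⁻ (suc c + length X) (length X) (λ y∈ → y∉ (∈-++⁺ˡ y∈))))
          (withWitnesses-agrees V l y (λ y∈ → y∉ (∈-++⁺ʳ (minus it) y∈)))

  withWitnesses-minus : ∀ {B c its c'} V → Layout B c its c' → All (WitnessesAt (withWitnesses V its) V) its
  withWitnesses-minus V [] = []
  withWitnesses-minus {its = it ∷ its} V (cons {c = c} {X = X} _ _ l) =
    (λ j j< → overwrite-inside (suc c + length X) (length X) _ _ j j<)
    ∷ All.zipWith (λ { {it'} (wit , c'≤p) j j< →
                        trans (overwrite-outside (suc c + length X) (length X) _ (withWitnesses V its) _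
                                                 (inj₂ (≤-trans c'≤p (<⇒≤ (pvar<minusVar it' j))))) (wit j j<) })
                  (withWitnesses-minus V l , Layout-pvar-≥ l)

  plusValue : Valuation → Valuation → Item → ℕ → Bool
  plusValue V U it j =
    if itemValue V it xor uniform (quant it) then blockWitness V it (nth (vars it) j) else U (minusVar it j)

  plusValue-uniform : ∀ V U it j → itemValue V it ≡ uniform (quant it) → plusValue V U it j ≡ U (minusVar it j)
  plusValue-uniform V U it j uni rewrite uni =
    cong (λ b → if b then blockWitness V it (nth (vars it) j) else U (minusVar it j)) (xor-same (uniform (quant it)))

  plusValue-non-uniform : ∀ V U it j → itemValue V it ≡ not (uniform (quant it)) →
                          plusValue V U it j ≡ blockWitness V it (nth (vars it) j)
  plusValue-non-uniform V U it j non rewrite non =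
    cong (λ b → if b then blockWitness V it (nth (vars it) j) else U (minusVar it j)) (xor-inverseˡ (uniform (quant it)))

  withItemValues : Valuation → Valuation → List Item → Valuation
  withItemValues V U []         = U
  withItemValues V U (it ∷ its) =
    overwrite (suc (pvar it)) (length (vars it)) (plusValue V U it) (withItemValues V U its [ pvar it ≔ itemValue V it ])

  withItemValues-agrees : ∀ {B c its c'} V U → Layout B c its c' → AgreeOff (pVars its) (withItemValues V U its) U
  withItemValues-agrees V U [] y _ = refl
  withItemValues-agrees {its = it ∷ its} V U (cons {c = c} {X = X} _ _ l) y y∉ =
    let (y≢c , y∉plus , y∉rest) = ∉-pVars-∷⁻ it its y∉
    in trans (overwrite-outside _ _ _ _ y (∉-block⁻ (suc c) (length X) y∉plus))
             (trans (≔-other _ c _ y (λ e → y≢c (sym e))) (withItemValues-agrees V U l y y∉rest))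

  withItemValues-∷-above : ∀ V U it its y → suc (pvar it) + length (vars it) + length (vars it) ≤ y →
                           withItemValues V U (it ∷ its) y ≡ withItemValues V U its y
  withItemValues-∷-above V U it its y above =
    trans (overwrite-outside (suc (pvar it)) n (plusValue V U it) _ y (inj₂ (≤-trans (m≤m+n _ n) above)))
          (≔-other _ (pvar it) (itemValue V it) y (λ e → <⇒≢ (<-≤-trans (item-width (pvar it) n) above) e))
    where n = length (vars it)

  withItemValues-pvar : ∀ {B c its c'} V U → Layout B c its c' →
                        All (λ it → withItemValues V U its (pvar it) ≡ itemValue V it) its
  withItemValues-pvar V U [] = []
  withItemValues-pvar {its = it ∷ its} V U (cons {c = c} {X = X} _ _ l) =
    trans (overwrite-outside (suc c) (length X) (plusValue V U it) _ c (inj₁ ≤-refl))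
          (≔-same (withItemValues V U its) c (itemValue V it))
    ∷ All.zipWith (λ { {it'} (val , c'≤p) → trans (withItemValues-∷-above V U it its (pvar it') c'≤p) val })
                  (withItemValues-pvar V U l , Layout-pvar-≥ l)

  withItemValues-plus : ∀ {B c its c'} V U → Layout B c its c' →
    All (λ it → ∀ j → j < length (vars it) → withItemValues V U its (plusVar it j) ≡ plusValue V U it j) its
  withItemValues-plus V U [] = []
  withItemValues-plus {its = it ∷ its} V U (cons {c = c} {X = X} _ _ l) =
    (λ j j< → overwrite-inside (suc c) (length X) _ _ j j<)
    ∷ All.zipWith (λ { {it'} (val , c'≤p) j j< →
                        trans (withItemValues-∷-above V U it its (plusVar it' j) (≤-trans c'≤p (pvar≤plusVar it' j)))
                              (val j j<) })
                  (withItemValues-plus V U l , Layout-pvar-≥ l)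

  -- One translation step

  PlusPrescribed : Valuation → Valuation → Item → Set
  PlusPrescribed W V it =
      (itemValue V it ≡ uniform (quant it) →
         ∀ j → j < length (vars it) → W (plusVar it j) ≡ W (minusVar it j))
    × (itemValue V it ≡ not (uniform (quant it)) →
         ∀ j → j < length (vars it) → W (plusVar it j) ≡ blockWitness V it (nth (vars it) j))

  all-constraints-hold : ∀ {B c its c'} → Layout B c its c' → ∀ V W → AgreeBelow B W V →
    All (λ it → W (pvar it) ≡ itemValue V it) its → All (PlusPrescribed W V) its → All (ItemConstraints W) its
  all-constraints-hold [] V W W≈V _ _ = []
  all-constraints-hold (cons {q = q} {X = X} {φ = φ} φB B≤c l) V W W≈V (p≡ ∷ ps) ((copies , witnesses) ∷ hs) =
    ItemSemantics.constraints-hold q X φ φB B≤c V W W≈V p≡ copies witnesses ∷ all-constraints-hold l V W W≈V ps hs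

  all-pvars-determined : ∀ {B c its c'} → Layout B c its c' → ∀ V W → AgreeBelow B W V →
    All (ItemConstraints W) its → All (WitnessesAt W V) its → All (λ it → W (pvar it) ≡ itemValue V it) its
  all-pvars-determined [] V W W≈V _ _ = []
  all-pvars-determined (cons {q = q} {X = X} {φ = φ} φB B≤c l) V W W≈V (k ∷ ks) (m ∷ ms) =
    ItemSemantics.pvar-determined q X φ φB B≤c V W W≈V k m ∷ all-pvars-determined l V W W≈V ks ms

  module OneStep (φ : Formula) (r : Step) {c₀ c' : ℕ}
                 (d : IsDecomposition (bound φ) c₀ φ (beta r) (items r) c') (B≤c₀ : bound φ ≤ c₀) where
    private
      its = items r
      l   = IsDecomposition.layout d

      below∉pVars : ∀ y → y < bound φ → y ∉ pVars its
      below∉pVars y y< y∈ = <⇒≱ (<-≤-trans y< B≤c₀) (pVars-≥ l y∈)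

      below∉nVars : ∀ y → y < bound φ → y ∉ nVars its
      below∉nVars y y< y∈ = <⇒≱ (<-≤-trans y< B≤c₀) (nVars-≥ l y∈)

    withItemValues-sound : ∀ V U → AgreeOff (nVars its) U V →
      let W = withItemValues V U its in AgreeOff (pVars its) W U × W ⊨ A r × eval W (beta r) ≡ eval V φ
    withItemValues-sound V U U≈V = W≈U , constraints⇒⊨A W r (all-constraints-hold l V W W≈V pvars prescribed) ,
                                   IsDecomposition.eval-≡ d V W W≈V pvars
      where
      W     = withItemValues V U its
      W≈U   = withItemValues-agrees V U l
      W≈V : AgreeBelow (bound φ) W V
      W≈V y y< = trans (W≈U y (below∉pVars y y<)) (U≈V y (below∉nVars y y<))
      pvars = withItemValues-pvar V U l
      prescribed : All (PlusPrescribed W V) its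
      prescribed = All.zipWith
        (λ { {it} (plus≡ , minus∉) →
               (λ uni j j< → trans (plus≡ j j<) (trans (plusValue-uniform V U it j uni) (sym (W≈U _ (minus∉ j j<)))))
             , (λ non j j< → trans (plus≡ j j<) (plusValue-non-uniform V U it j non)) })
        (withItemValues-plus V U l , minus∉pVars l)

    β-forced : ∀ V W → AgreeOff (pVars its) W (withWitnesses V its) → W ⊨ A r → eval W (beta r) ≡ eval V φ
    β-forced V W W≈ ⊨A =
      IsDecomposition.eval-≡ d V W W≈V (all-pvars-determined l V W W≈V (⊨A⇒constraints W r ⊨A) witnesses)
      where
      W≈V : AgreeBelow (bound φ) W V
      W≈V y y< = trans (W≈ y (below∉pVars y y<)) (withWitnesses-agrees V l y (below∉nVars y y<))
      witnesses : All (WitnessesAt W V) its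
      witnesses = All.zipWith (λ { (wit , minus∉) j j< → trans (W≈ _ (minus∉ j j<)) (wit j j<) })
                              (withWitnesses-minus V l , minus∉pVars l)

    T-sound : ∀ Q V → evalQ Q (N r) V (λ U → evalQ (dual Q) (P r) U (λ W → eval W (T Q r))) ≡ eval V φ
    T-sound ex V = ≡-from-truth to from
      where
      to : _ → V ⊨ φ
      to h with ∃-elim (nVars its) V h
      ... | U , U≈V , ⊨∀ with withItemValues-sound V U U≈V
      ...   | W≈U , ⊨A , β≡φ = trans (sym β≡φ)
              (⊨-⇒⁻ _ (A r) (beta r) (∀-elim (eval-extensional (A r ⇒f beta r)) (pVars its) U _ W≈U ⊨∀) ⊨A)
      from : V ⊨ φ → _
      from ⊨φ = ∃-intro (evalQ-extensional (eval-extensional (A r ⇒f beta r)) all (pVars its)) (nVars its) V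
                  (withWitnesses V its) (withWitnesses-agrees V l)
                  (∀-intro (pVars its) _ λ W W≈ →
                     ⊨-⇒⁺ W (A r) (beta r) (λ ⊨A → trans (β-forced V W W≈ ⊨A) ⊨φ))
    T-sound all V = ≡-from-truth to from
      where
      to : _ → V ⊨ φ
      to h with ∃-elim (pVars its) (withWitnesses V its)
                  (∀-elim (evalQ-extensional (eval-extensional (A r ∧f beta r)) ex (pVars its)) (nVars its) V
                          (withWitnesses V its) (withWitnesses-agrees V l) h)
      ... | W , W≈ , ⊨A∧β =
        let (⊨A , ⊨β) = ⊨-∧⁻ W (A r) (beta r) ⊨A∧β in trans (sym (β-forced V W W≈ ⊨A)) ⊨β
      from : V ⊨ φ → _
      from ⊨φ = ∀-intro (nVars its) V (λ U U≈V →
        let (W≈U , ⊨A , β≡φ) = withItemValues-sound V U U≈V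
        in ∃-intro (eval-extensional (A r ∧f beta r)) (pVars its) U _ W≈U
                   (⊨-∧⁺ _ (A r) (beta r) ⊨A (trans β≡φ ⊨φ)))

  -- Depth

  mutual
    depth-rename : ∀ ρ φ → depth (rename ρ φ) ≡ depth φ
    depth-rename ρ (var x)    = refl
    depth-rename ρ (op o as)  = depthVec-rename ρ as
    depth-rename ρ (qb q X φ) = cong suc (depth-rename _ φ)

    depthVec-rename : ∀ {k} ρ (as : Vec Formula k) → depthVec (renameVec ρ as) ≡ depthVec as
    depthVec-rename ρ []       = refl
    depthVec-rename ρ (a ∷ as) = cong₂ _⊔_ (depth-rename ρ a) (depthVec-rename ρ as)

  mutual
    boolean⇒depth≡0 : ∀ φ → Boolean φ → depth φ ≡ 0
    boolean⇒depth≡0 (var x)   _ = refl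
    boolean⇒depth≡0 (op o as) h = booleanVec⇒depth≡0 as h

    booleanVec⇒depth≡0 : ∀ {k} (as : Vec Formula k) → isBoolVec as ≡ true → depthVec as ≡ 0
    booleanVec⇒depth≡0 []       _ = refl
    booleanVec⇒depth≡0 (a ∷ as) h =
      cong₂ _⊔_ (boolean⇒depth≡0 a (∧-conicalˡ _ _ h)) (booleanVec⇒depth≡0 as (∧-conicalʳ _ _ h))

  mutual
    depth≡0⇒boolean : ∀ φ → depth φ ≡ 0 → Boolean φ
    depth≡0⇒boolean (var x)   _ = refl
    depth≡0⇒boolean (op o as) h = depthVec≡0⇒boolean as h

    depthVec≡0⇒boolean : ∀ {k} (as : Vec Formula k) → depthVec as ≡ 0 → isBoolVec as ≡ true
    depthVec≡0⇒boolean []       _ = refl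
    depthVec≡0⇒boolean (a ∷ as) h =
      ∧-intro (depth≡0⇒boolean a (m⊔n≡0⇒m≡0 h)) (depthVec≡0⇒boolean as (m⊔n≡0⇒n≡0 (depth a) h))
      where
      m⊔n≡0⇒m≡0 : ∀ {m n} → m ⊔ n ≡ 0 → m ≡ 0
      m⊔n≡0⇒m≡0 {m} {n} e = n≤0⇒n≡0 (subst (m ≤_) e (m≤m⊔n m n))
      m⊔n≡0⇒n≡0 : ∀ m {n} → m ⊔ n ≡ 0 → n ≡ 0
      m⊔n≡0⇒n≡0 m {n} e = n≤0⇒n≡0 (subst (n ≤_) e (m≤n⊔m m n))

  depth-⋀ : ∀ L → All (λ f → depth f ≡ 0) L → depth (⋀ L) ≡ 0
  depth-⋀ []          _            = refl
  depth-⋀ (a ∷ [])    (d ∷ [])     = d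
  depth-⋀ (a ∷ b ∷ L) (d ∷ ds) rewrite d | depth-⋀ (b ∷ L) ds = refl

  depth-eqs : ∀ it → depth (eqs it) ≡ 0
  depth-eqs it = depth-⋀ _ (equivalences-depth (plus it) (minus it))
    where
    equivalences-depth : ∀ L M → All (λ f → depth f ≡ 0) (equivalences L M)
    equivalences-depth []      M       = []
    equivalences-depth (x ∷ L) []      = []
    equivalences-depth (x ∷ L) (y ∷ M) = refl ∷ equivalences-depth L M

  exGuards-depth : ∀ its → All (λ f → depth f ≡ 0) (exGuards its)
  exGuards-depth []                          = []
  exGuards-depth (it@(item ex  _ _ _ _ _) ∷ its) = trans (⊔-identityʳ _) (depth-eqs it) ∷ exGuards-depth its
  exGuards-depth (item all _ _ _ _ _ ∷ its)  = exGuards-depth its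

  allGuards-depth : ∀ its → All (λ f → depth f ≡ 0) (allGuards its)
  allGuards-depth []                          = []
  allGuards-depth (item ex  _ _ _ _ _ ∷ its)  = allGuards-depth its
  allGuards-depth (it@(item all _ _ _ _ _) ∷ its) = trans (⊔-identityʳ _) (depth-eqs it) ∷ allGuards-depth its

  defs-depth : ∀ its → depth (⋀ (defs its)) ≡ bodyDepth its
  defs-depth []               = refl
  defs-depth (it ∷ [])        = trans (⊔-identityʳ _) (trans (depth-rename (σ it) (body it)) (sym (⊔-identityʳ _)))
  defs-depth (it ∷ it' ∷ its) =
    cong₂ _⊔_ (trans (⊔-identityʳ _) (depth-rename (σ it) (body it)))
              (trans (⊔-identityʳ _) (defs-depth (it' ∷ its)))

  A-depth : ∀ r → depth (A r) ≡ bodyDepth (items r)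
  A-depth r rewrite depth-⋀ _ (exGuards-depth (items r)) | depth-⋀ _ (allGuards-depth (items r))
                  | defs-depth (items r) = ⊔-identityʳ _

  T-depth : ∀ Q r → Boolean (beta r) → depth (T Q r) ≡ bodyDepth (items r)
  T-depth ex  r h rewrite boolean⇒depth≡0 (beta r) h | A-depth r = ⊔-identityʳ _
  T-depth all r h rewrite boolean⇒depth≡0 (beta r) h | A-depth r = ⊔-identityʳ _

  depth-step : ∀ Q b φ → isBool φ ≡ false → depth φ ≡ suc (depth (T Q (step b φ)))
  depth-step Q b φ nb with step-correct b φ
  ... | _ , d with items (step b φ) | IsDecomposition.no-items⇒boolean d | IsDecomposition.depth-≡ d
                 | T-depth Q (step b φ) (IsDecomposition.β-boolean d)
  ...   | []       | boolean | _       | _      = ⊥-elim (not-≢-self false (trans (sym (boolean refl)) nb))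
  ...   | it ∷ its | _       | depth≡ | Tdepth = trans depth≡ (trans (quantDepth-∷ it its) (cong suc (sym Tdepth)))

  boolean⇒N≡[] : ∀ b φ → Boolean φ → N (step b φ) ≡ []
  boolean⇒N≡[] b φ h = cong (concatMap minus) (IsDecomposition.boolean⇒no-items (proj₂ (step-correct b φ)) h)

  -- The translations

  depth-T≤ : ∀ Q n b φ → depth φ ≤ suc n → isBool φ ≡ false → depth (T Q (step b φ)) ≤ n
  depth-T≤ Q n b φ d≤ nb = s≤s⁻¹ (subst (_≤ suc n) (depth-step Q b φ nb) d≤)

  TrAux-sound : ∀ Q n b φ → depth φ ≤ n →
                ∀ V → evalQ Q (N (step b φ)) V (λ U → eval U (TrAux Q n b φ)) ≡ eval V φ
  TrAux-sound Q zero b φ d≤ V rewrite boolean⇒N≡[] b φ (depth≡0⇒boolean φ (n≤0⇒n≡0 d≤)) = refl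
  TrAux-sound Q (suc n) b φ d≤ V with isBool φ in isBoolφ
  ... | true rewrite boolean⇒N≡[] b φ isBoolφ = refl
  ... | false = begin
    evalQ Q (N r) V (λ U → evalQ (dual Q) (P r ++ N (step b ψ)) U (λ W → eval W (TrAux (dual Q) n b ψ)))
      ≡⟨ evalQ-cong (λ U → evalQ-++ (dual Q) (P r) (N (step b ψ)) U _) Q (N r) V ⟩
    evalQ Q (N r) V (λ U → evalQ (dual Q) (P r) U (λ W →
      evalQ (dual Q) (N (step b ψ)) W (λ W' → eval W' (TrAux (dual Q) n b ψ))))
      ≡⟨ evalQ-cong (λ U → evalQ-cong (TrAux-sound (dual Q) n b ψ (depth-T≤ Q n b φ d≤ isBoolφ)) (dual Q) (P r) U)
                    Q (N r) V ⟩
    evalQ Q (N r) V (λ U → evalQ (dual Q) (P r) U (λ W → eval W ψ))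
      ≡⟨ OneStep.T-sound φ r (proj₂ (step-correct b φ)) (m≤n⊔m b (bound φ)) Q V ⟩
    eval V φ ∎
    where
    open ≡-Reasoning
    r = step b φ
    ψ = T Q r

  TrAux-prenex : ∀ Q n b φ → depth φ ≤ n → Prenex (TrAux Q n b φ)
  TrAux-prenex Q zero    b φ d≤ = prenex-bool (depth≡0⇒boolean φ (n≤0⇒n≡0 d≤))
  TrAux-prenex Q (suc n) b φ d≤ with isBool φ in isBoolφ
  ... | true  = prenex-bool isBoolφ
  ... | false = prenex-quant (TrAux-prenex (dual Q) n b _ (depth-T≤ Q n b φ d≤ isBoolφ))

  TrAux-depth : ∀ Q n b φ → depth φ ≤ n → depth (TrAux Q n b φ) ≡ depth φ
  TrAux-depth Q zero    b φ d≤ = refl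
  TrAux-depth Q (suc n) b φ d≤ with isBool φ in isBoolφ
  ... | true  = refl
  ... | false = trans (cong suc (TrAux-depth (dual Q) n b _ (depth-T≤ Q n b φ d≤ isBoolφ))) (sym (depth-step Q b φ isBoolφ))

  mutual
    mcAux-sound : ∀ b φ V → eval V (mcAux b φ) ≡ eval V φ
    mcAux-sound b (var x)    V = refl
    mcAux-sound b (op o as)  V = cong ⟦ o ⟧ (mcAuxVec-sound b as V)
    mcAux-sound b (qb q X φ) V =
      trans (evalQ-++ q (dedup X) (N (step b φ)) V _)
            (trans (evalQ-cong (TrAux-sound q (depth φ) b φ ≤-refl) q (dedup X) V) (evalQ-dedup (eval-extensional φ) q X V))

    mcAuxVec-sound : ∀ {k} b (as : Vec Formula k) V → evalVec V (mcAuxVec b as) ≡ evalVec V as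
    mcAuxVec-sound b []       V = refl
    mcAuxVec-sound b (a ∷ as) V = cong₂ _∷_ (mcAux-sound b a V) (mcAuxVec-sound b as V)

  mutual
    mcAux-boolCombPrenex : ∀ b φ → BoolCombPrenex (mcAux b φ)
    mcAux-boolCombPrenex b (var x)    = bcp-var
    mcAux-boolCombPrenex b (op o as)  = bcp-op (mcAuxVec-boolCombPrenex b as)
    mcAux-boolCombPrenex b (qb q X φ) = bcp-quant (prenex-quant (TrAux-prenex q (depth φ) b φ ≤-refl))

    mcAuxVec-boolCombPrenex : ∀ {k} b (as : Vec Formula k) → VecAll.All BoolCombPrenex (mcAuxVec b as)
    mcAuxVec-boolCombPrenex b []       = VecAll.[]
    mcAuxVec-boolCombPrenex b (a ∷ as) = mcAux-boolCombPrenex b a VecAll.∷ mcAuxVec-boolCombPrenex b as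

  mutual
    mcAux-depth : ∀ b φ → depth (mcAux b φ) ≡ depth φ
    mcAux-depth b (var x)    = refl
    mcAux-depth b (op o as)  = mcAuxVec-depth b as
    mcAux-depth b (qb q X φ) = cong suc (TrAux-depth q (depth φ) b φ ≤-refl)

    mcAuxVec-depth : ∀ {k} b (as : Vec Formula k) → depthVec (mcAuxVec b as) ≡ depthVec as
    mcAuxVec-depth b []       = refl
    mcAuxVec-depth b (a ∷ as) = cong₂ _⊔_ (mcAux-depth b a) (mcAuxVec-depth b as)

  -- Length

  mutual
    size-rename : ∀ ρ φ → size (rename ρ φ) ≡ size φ
    size-rename ρ (var x)    = refl
    size-rename ρ (op o as)  = cong suc (sizeVec-rename ρ as)
    size-rename ρ (qb q X φ) = cong (λ s → suc (length (dedup X) + s)) (size-rename _ φ)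

    sizeVec-rename : ∀ {k} ρ (as : Vec Formula k) → sizeVec (renameVec ρ as) ≡ sizeVec as
    sizeVec-rename ρ []       = refl
    sizeVec-rename ρ (a ∷ as) = cong₂ _+_ (size-rename ρ a) (sizeVec-rename ρ as)

  mutual
    quantSize-rename : ∀ ρ φ → quantSize (rename ρ φ) ≡ quantSize φ
    quantSize-rename ρ (var x)    = refl
    quantSize-rename ρ (op o as)  = quantSizeVec-rename ρ as
    quantSize-rename ρ (qb q X φ) = cong (λ s → suc (length (dedup X) + s)) (quantSize-rename _ φ)

    quantSizeVec-rename : ∀ {k} ρ (as : Vec Formula k) → quantSizeVec (renameVec ρ as) ≡ quantSizeVec as
    quantSizeVec-rename ρ []       = refl
    quantSizeVec-rename ρ (a ∷ as) = cong₂ _+_ (quantSize-rename ρ a) (quantSizeVec-rename ρ as)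

  mutual
    boolean⇒quantSize≡0 : ∀ φ → Boolean φ → quantSize φ ≡ 0
    boolean⇒quantSize≡0 (var x)   _ = refl
    boolean⇒quantSize≡0 (op o as) h = booleanVec⇒quantSize≡0 as h

    booleanVec⇒quantSize≡0 : ∀ {k} (as : Vec Formula k) → isBoolVec as ≡ true → quantSizeVec as ≡ 0
    booleanVec⇒quantSize≡0 []       _ = refl
    booleanVec⇒quantSize≡0 (a ∷ as) h =
      cong₂ _+_ (boolean⇒quantSize≡0 a (∧-conicalˡ _ _ h)) (booleanVec⇒quantSize≡0 as (∧-conicalʳ _ _ h))

  mutual
    quantSize≤size : ∀ φ → quantSize φ ≤ size φ
    quantSize≤size (var x)    = z≤n
    quantSize≤size (op o as)  = m≤n⇒m≤1+n (quantSizeVec≤sizeVec as)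
    quantSize≤size (qb q X φ) = s≤s (+-monoʳ-≤ (length (dedup X)) (quantSize≤size φ))

    quantSizeVec≤sizeVec : ∀ {k} (as : Vec Formula k) → quantSizeVec as ≤ sizeVec as
    quantSizeVec≤sizeVec []       = z≤n
    quantSizeVec≤sizeVec (a ∷ as) = +-mono-≤ (quantSize≤size a) (quantSizeVec≤sizeVec as)

  mutual
    depth≤size : ∀ φ → depth φ ≤ size φ
    depth≤size (var x)    = z≤n
    depth≤size (op o as)  = m≤n⇒m≤1+n (depthVec≤sizeVec as)
    depth≤size (qb q X φ) = s≤s (≤-trans (depth≤size φ) (m≤n+m (size φ) (length (dedup X))))

    depthVec≤sizeVec : ∀ {k} (as : Vec Formula k) → depthVec as ≤ sizeVec as
    depthVec≤sizeVec []       = z≤n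
    depthVec≤sizeVec (a ∷ as) =
      ≤-trans (⊔-mono-≤ (depth≤size a) (depthVec≤sizeVec as)) (m⊔n≤m+n (size a) (sizeVec as))

  listSize : List Formula → ℕ
  listSize L = sum (map (λ f → suc (size f)) L)

  size-⋀ : ∀ L → size (⋀ L) ≤ listSize L + 2
  size-⋀ []          = ≤-refl
  size-⋀ (a ∷ [])    = ≤-trans (n≤1+n (size a)) (≤-trans (m≤m+n (suc (size a)) 0) (m≤m+n _ 2))
  size-⋀ (a ∷ b ∷ L) = begin
    suc (size a + (size (⋀ (b ∷ L)) + 0))   ≤⟨ s≤s (+-monoʳ-≤ (size a) (+-monoˡ-≤ 0 (size-⋀ (b ∷ L)))) ⟩
    suc (size a + ((listSize (b ∷ L) + 2) + 0)) ≡⟨ regroup (size a) (listSize (b ∷ L)) ⟩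
    suc (size a) + listSize (b ∷ L) + 2     ∎
    where
    open ≤-Reasoning
    regroup : ∀ x y → suc (x + ((y + 2) + 0)) ≡ suc x + y + 2
    regroup = solve-∀

  quantSize-⋀ : ∀ L → quantSize (⋀ L) ≡ sum (map quantSize L)
  quantSize-⋀ []          = refl
  quantSize-⋀ (a ∷ [])    = sym (+-identityʳ _)
  quantSize-⋀ (a ∷ b ∷ L) = cong (quantSize a +_) (trans (+-identityʳ _) (quantSize-⋀ (b ∷ L)))

  size-eqs : ∀ it → size (eqs it) ≤ 4 * length (plus it) + 2
  size-eqs it = ≤-trans (size-⋀ (equivalences (plus it) (minus it))) (+-monoˡ-≤ 2 (equivalences-size (plus it) (minus it)))
    where
    equivalences-size : ∀ L M → listSize (equivalences L M) ≤ 4 * length L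
    equivalences-size []      M       = z≤n
    equivalences-size (x ∷ L) []      = z≤n
    equivalences-size (x ∷ L) (y ∷ M) =
      subst (4 + listSize (equivalences L M) ≤_) (sym (*-suc 4 (length L))) (+-monoʳ-≤ 4 (equivalences-size L M))

  quantSize-eqs : ∀ it → quantSize (eqs it) ≡ 0
  quantSize-eqs it = trans (quantSize-⋀ (equivalences (plus it) (minus it))) (equivalences-quantSize (plus it) (minus it))
    where
    equivalences-quantSize : ∀ L M → sum (map quantSize (equivalences L M)) ≡ 0
    equivalences-quantSize []      M       = refl
    equivalences-quantSize (x ∷ L) []      = refl
    equivalences-quantSize (x ∷ L) (y ∷ M) = equivalences-quantSize L M

  listSize-defs : ∀ its → listSize (defs its) ≡ bodySize its + 3 * length its
  listSize-defs []         = refl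
  listSize-defs (it ∷ its) rewrite size-rename (σ it) (body it) | listSize-defs its =
    regroup (size (body it)) (bodySize its) (length its)
    where
    regroup : ∀ s S k → 3 + (s + 0) + (S + 3 * k) ≡ s + S + 3 * suc k
    regroup = solve-∀

  listSize-guards : ∀ {B c its c'} → Layout B c its c' →
                    listSize (exGuards its) + listSize (allGuards its) ≤ 4 * varCount its + 6 * length its
  listSize-guards [] = z≤n
  listSize-guards {its = it ∷ its} (cons {c = c} {q = ex} {X = X} _ _ l) = begin
    4 + (size (eqs it) + 0) + G + G'    ≡⟨ regroup (size (eqs it)) G G' ⟩
    size (eqs it) + (G + G') + 4         ≤⟨ +-monoˡ-≤ 4 (+-mono-≤ (size-eqs it) (listSize-guards l)) ⟩
    (4 * length (plus it) + 2) + (4 * varCount its + 6 * length its) + 4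
      ≡⟨ cong (λ n → (4 * n + 2) + (4 * varCount its + 6 * length its) + 4) (length-block (suc c) (length X)) ⟩
    (4 * length X + 2) + (4 * varCount its + 6 * length its) + 4 ≡⟨ total (length X) (varCount its) (length its) ⟩
    4 * (length X + varCount its) + 6 * suc (length its) ∎
    where
    open ≤-Reasoning
    G  = listSize (exGuards its)
    G' = listSize (allGuards its)
    regroup : ∀ e g g' → 4 + (e + 0) + g + g' ≡ e + (g + g') + 4
    regroup = solve-∀
    total : ∀ n v k → (4 * n + 2) + (4 * v + 6 * k) + 4 ≡ 4 * (n + v) + 6 * suc k
    total = solve-∀
  listSize-guards {its = it ∷ its} (cons {c = c} {q = all} {X = X} _ _ l) = begin
    G + (3 + (size (eqs it) + 0) + G')   ≡⟨ regroup (size (eqs it)) G G' ⟩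
    size (eqs it) + (G + G') + 3         ≤⟨ +-monoˡ-≤ 3 (+-mono-≤ (size-eqs it) (listSize-guards l)) ⟩
    (4 * length (plus it) + 2) + (4 * varCount its + 6 * length its) + 3
      ≡⟨ cong (λ n → (4 * n + 2) + (4 * varCount its + 6 * length its) + 3) (length-block (suc c) (length X)) ⟩
    (4 * length X + 2) + (4 * varCount its + 6 * length its) + 3 ≤⟨ m≤m+n _ 1 ⟩
    (4 * length X + 2) + (4 * varCount its + 6 * length its) + 3 + 1 ≡⟨ total (length X) (varCount its) (length its) ⟩
    4 * (length X + varCount its) + 6 * suc (length its) ∎
    where
    open ≤-Reasoning
    G  = listSize (exGuards its)
    G' = listSize (allGuards its)
    regroup : ∀ e g g' → g + (3 + (e + 0) + g') ≡ e + (g + g') + 3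
    regroup = solve-∀
    total : ∀ n v k → (4 * n + 2) + (4 * v + 6 * k) + 3 + 1 ≡ 4 * (n + v) + 6 * suc k
    total = solve-∀

  size-T : ∀ {B c c'} Q r → Layout B c (items r) c' →
    size (T Q r) ≤ 9 + size (beta r) + bodySize (items r) + 9 * length (items r) + 4 * varCount (items r)
  size-T Q r l = begin
    size (T Q r)                                               ≡⟨ shape Q ⟩
    suc (suc (size D + (suc (size E + (size F + 0)) + 0)) + (size (beta r) + 0))
      ≡⟨ regroup (size D) (size E) (size F) (size (beta r)) ⟩
    size D + (size E + size F) + size (beta r) + 3
      ≤⟨ +-monoˡ-≤ 3 (+-monoˡ-≤ (size (beta r)) (+-mono-≤ D≤ E+F≤)) ⟩
    (bodySize its + 3 * length its + 2) + (4 * varCount its + 6 * length its + 4) + size (beta r) + 3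
      ≡⟨ total (size (beta r)) (bodySize its) (length its) (varCount its) ⟩
    9 + size (beta r) + bodySize its + 9 * length its + 4 * varCount its ∎
    where
    open ≤-Reasoning
    its = items r
    D = ⋀ (defs its)
    E = ⋀ (exGuards its)
    F = ⋀ (allGuards its)
    shape : ∀ Q → size (T Q r) ≡ suc (size (A r) + (size (beta r) + 0))
    shape ex  = refl
    shape all = refl
    D≤ : size D ≤ bodySize its + 3 * length its + 2
    D≤ = subst (λ n → size D ≤ n + 2) (listSize-defs its) (size-⋀ (defs its))
    E+F≤ : size E + size F ≤ 4 * varCount its + 6 * length its + 4
    E+F≤ = begin
      size E + size F
        ≤⟨ +-mono-≤ (size-⋀ (exGuards its)) (size-⋀ (allGuards its)) ⟩
      (listSize (exGuards its) + 2) + (listSize (allGuards its) + 2)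
        ≡⟨ regroup' (listSize (exGuards its)) (listSize (allGuards its)) ⟩
      (listSize (exGuards its) + listSize (allGuards its)) + 4     ≤⟨ +-monoˡ-≤ 4 (listSize-guards l) ⟩
      4 * varCount its + 6 * length its + 4                        ∎
      where
      regroup' : ∀ e f → (e + 2) + (f + 2) ≡ (e + f) + 4
      regroup' = solve-∀
    regroup : ∀ d e f b → suc (suc (d + (suc (e + (f + 0)) + 0)) + (b + 0)) ≡ d + (e + f) + b + 3
    regroup = solve-∀
    total : ∀ b s k v → (s + 3 * k + 2) + (4 * v + 6 * k + 4) + b + 3 ≡ 9 + b + s + 9 * k + 4 * v
    total = solve-∀

  quantSize-T : ∀ Q r → Boolean (beta r) → quantSize (T Q r) ≡ bodyQuantSize (items r)
  quantSize-T Q r h = begin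
    quantSize (T Q r)                                                   ≡⟨ shape Q ⟩
    quantSize (⋀ (defs its)) + ((quantSize (⋀ (exGuards its)) + (quantSize (⋀ (allGuards its)) + 0)) + 0)
      + (quantSize (beta r) + 0)
      ≡⟨ cong₂ (λ d g → d + g + (quantSize (beta r) + 0)) (trans (quantSize-⋀ (defs its)) (defs-quantSize its))
               (cong₂ (λ e a → (e + (a + 0)) + 0) (trans (quantSize-⋀ (exGuards its)) (exGuards-quantSize its))
                                                  (trans (quantSize-⋀ (allGuards its)) (allGuards-quantSize its))) ⟩
    bodyQuantSize its + 0 + (quantSize (beta r) + 0)
      ≡⟨ cong (λ q → bodyQuantSize its + 0 + (q + 0)) (boolean⇒quantSize≡0 (beta r) h) ⟩
    bodyQuantSize its + 0 + 0                                           ≡⟨ trans (+-identityʳ _) (+-identityʳ _) ⟩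
    bodyQuantSize its                                                   ∎
    where
    open ≡-Reasoning
    its = items r
    shape : ∀ Q → quantSize (T Q r) ≡ quantSize (A r) + (quantSize (beta r) + 0)
    shape ex  = refl
    shape all = refl
    defs-quantSize : ∀ its → sum (map quantSize (defs its)) ≡ bodyQuantSize its
    defs-quantSize []         = refl
    defs-quantSize (it ∷ its) rewrite quantSize-rename (σ it) (body it) | +-identityʳ (quantSize (body it)) =
      cong (quantSize (body it) +_) (defs-quantSize its)
    exGuards-quantSize : ∀ its → sum (map quantSize (exGuards its)) ≡ 0
    exGuards-quantSize []                              = refl
    exGuards-quantSize (it@(item ex  _ _ _ _ _) ∷ its) rewrite quantSize-eqs it = exGuards-quantSize its
    exGuards-quantSize (item all _ _ _ _ _ ∷ its)      = exGuards-quantSize its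
    allGuards-quantSize : ∀ its → sum (map quantSize (allGuards its)) ≡ 0
    allGuards-quantSize []                              = refl
    allGuards-quantSize (item ex  _ _ _ _ _ ∷ its)      = allGuards-quantSize its
    allGuards-quantSize (it@(item all _ _ _ _ _) ∷ its) rewrite quantSize-eqs it = allGuards-quantSize its

  length-nVars : ∀ {B c its c'} → Layout B c its c' → length (nVars its) ≡ varCount its
  length-nVars [] = refl
  length-nVars {its = it ∷ its} (cons {c = c} {X = X} _ _ l) =
    trans (length-++ (minus it)) (cong₂ _+_ (length-block (suc c + length X) (length X)) (length-nVars l))

  length-pVars : ∀ {B c its c'} → Layout B c its c' → length (pVars its) ≡ length its + varCount its
  length-pVars {its = its} l = trans (length-++ (map pvar its)) (cong₂ _+_ (length-map pvar its) (length-plus l))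
    where
    length-plus : ∀ {c its c'} → Layout _ c its c' → length (concatMap plus its) ≡ varCount its
    length-plus [] = refl
    length-plus {its = it ∷ its} (cons {c = c} {X = X} _ _ l) =
      trans (length-++ (plus it)) (cong₂ _+_ (length-block (suc c) (length X)) (length-plus l))

  potential : Formula → ℕ
  potential φ = size φ + 10 * quantSize φ + 10 * depth φ

  size≤potential : ∀ φ → size φ ≤ potential φ
  size≤potential φ = ≤-trans (m≤m+n (size φ) _) (m≤m+n _ (10 * depth φ))

  potential-step : ∀ Q b φ → isBool φ ≡ false →
    let r = step b φ in suc (length (P r) + length (N r)) + potential (T Q r) ≤ potential φ
  potential-step Q b φ nb = begin
    suc (length (P r) + length (N r)) + potential ψ
      ≤⟨ +-monoʳ-≤ (suc (length (P r) + length (N r)))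
           (+-monoˡ-≤ (10 * depth ψ)
              (+-mono-≤ (size-T Q r layout) (≤-reflexive (cong (10 *_) (quantSize-T Q r β-boolean))))) ⟩
    suc (length (P r) + length (N r)) + (9 + size β + Sb + 9 * k + 4 * L + 10 * Qb + 10 * depth ψ)
      ≡⟨ cong₂ (λ p m → suc (p + m) + (9 + size β + Sb + 9 * k + 4 * L + 10 * Qb + 10 * depth ψ))
               (length-pVars layout) (length-nVars layout) ⟩
    suc (k + L + L) + (9 + size β + Sb + 9 * k + 4 * L + 10 * Qb + 10 * depth ψ)
      ≤⟨ m≤m+n _ (5 * L) ⟩
    suc (k + L + L) + (9 + size β + Sb + 9 * k + 4 * L + 10 * Qb + 10 * depth ψ) + 5 * L
      ≡⟨ total k L (size β) Sb Qb (depth ψ) ⟩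
    (size β + (L + Sb)) + 10 * (k + L + Qb) + 10 * suc (depth ψ)
      ≡⟨ sym (cong₂ (λ s q → s + 10 * q + 10 * suc (depth ψ)) size-≡ quantSize-≡) ⟩
    size φ + 10 * quantSize φ + 10 * suc (depth ψ)
      ≡⟨ cong (λ d → size φ + 10 * quantSize φ + 10 * d) (sym (depth-step Q b φ nb)) ⟩
    potential φ ∎
    where
    open ≤-Reasoning
    r  = step b φ
    ψ  = T Q r
    β  = beta r
    k  = length (items r)
    L  = varCount (items r)
    Sb = bodySize (items r)
    Qb = bodyQuantSize (items r)
    open IsDecomposition (proj₂ (step-correct b φ))
    total : ∀ k L s S Q d → suc (k + L + L) + (9 + s + S + 9 * k + 4 * L + 10 * Q + 10 * d) + 5 * L
                          ≡ (s + (L + S)) + 10 * (k + L + Q) + 10 * suc d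
    total = solve-∀

  TrAux-size : ∀ Q n b φ → depth φ ≤ n → size (TrAux Q n b φ) + length (N (step b φ)) ≤ potential φ
  TrAux-size Q zero b φ d≤ rewrite boolean⇒N≡[] b φ (depth≡0⇒boolean φ (n≤0⇒n≡0 d≤)) =
    ≤-trans (≤-reflexive (+-identityʳ _)) (size≤potential φ)
  TrAux-size Q (suc n) b φ d≤ with isBool φ in isBoolφ
  ... | true rewrite boolean⇒N≡[] b φ isBoolφ = ≤-trans (≤-reflexive (+-identityʳ _)) (size≤potential φ)
  ... | false = begin
    suc (length (dedup (P r ++ N (step b ψ))) + size Trψ) + length (N r)
      ≤⟨ +-monoˡ-≤ (length (N r)) (s≤s (+-monoˡ-≤ (size Trψ)
           (≤-trans (length-deduplicate _≟_ (P r ++ N (step b ψ))) (≤-reflexive (length-++ (P r)))))) ⟩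
    suc (length (P r) + length (N (step b ψ)) + size Trψ) + length (N r)
      ≡⟨ regroup (length (P r)) (length (N (step b ψ))) (size Trψ) (length (N r)) ⟩
    suc (length (P r) + length (N r)) + (size Trψ + length (N (step b ψ)))
      ≤⟨ +-monoʳ-≤ (suc (length (P r) + length (N r))) (TrAux-size (dual Q) n b ψ (depth-T≤ Q n b φ d≤ isBoolφ)) ⟩
    suc (length (P r) + length (N r)) + potential ψ
      ≤⟨ potential-step Q b φ isBoolφ ⟩
    potential φ ∎
    where
    open ≤-Reasoning
    r   = step b φ
    ψ   = T Q r
    Trψ = TrAux (dual Q) n b ψ
    regroup : ∀ p m t n → suc (p + m + t) + n ≡ suc (p + n) + (t + m)
    regroup = solve-∀

  potential≤21*size : ∀ φ → potential φ ≤ 21 * size φ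
  potential≤21*size φ =
    ≤-trans (+-mono-≤ (+-monoʳ-≤ (size φ) (*-monoʳ-≤ 10 (quantSize≤size φ))) (*-monoʳ-≤ 10 (depth≤size φ)))
            (≤-reflexive (collect (size φ)))
    where
    collect : ∀ s → s + 10 * s + 10 * s ≡ 21 * s
    collect = solve-∀

  Tr-size : ∀ Q φ → size (Tr Q φ) ≤ 21 * size φ
  Tr-size Q φ = ≤-trans (m≤m+n _ _) (≤-trans (TrAux-size Q (depth φ) 0 φ ≤-refl) (potential≤21*size φ))

  mutual
    mcAux-size : ∀ b φ → size (mcAux b φ) ≤ 21 * size φ
    mcAux-size b (var x)    = s≤s z≤n
    mcAux-size b (op o as)  =
      ≤-trans (s≤s (mcAuxVec-size b as)) (≤-trans (m≤n+m _ 20) (≤-reflexive (collect (sizeVec as))))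
      where
      collect : ∀ s → 20 + suc (21 * s) ≡ 21 * suc s
      collect = solve-∀
    mcAux-size b (qb q X φ) = begin
      suc (length (dedup (dedup X ++ N (step b φ))) + size (TrAux q (depth φ) b φ))
        ≤⟨ s≤s (+-monoˡ-≤ _ (≤-trans (length-deduplicate _≟_ (dedup X ++ N (step b φ)))
                                      (≤-reflexive (length-++ (dedup X))))) ⟩
      suc (length (dedup X) + length (N (step b φ)) + size (TrAux q (depth φ) b φ))
        ≡⟨ cong suc (+-assoc (length (dedup X)) _ _) ⟩
      suc (length (dedup X) + (length (N (step b φ)) + size (TrAux q (depth φ) b φ)))
        ≡⟨ cong (λ m → suc (length (dedup X) + m)) (+-comm (length (N (step b φ))) _) ⟩
      suc (length (dedup X) + (size (TrAux q (depth φ) b φ) + length (N (step b φ))))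
        ≤⟨ s≤s (+-monoʳ-≤ (length (dedup X))
                          (≤-trans (TrAux-size q (depth φ) b φ ≤-refl) (potential≤21*size φ))) ⟩
      suc (length (dedup X) + 21 * size φ)
        ≤⟨ m≤m+n _ (20 * length (dedup X) + 20) ⟩
      suc (length (dedup X) + 21 * size φ) + (20 * length (dedup X) + 20)
        ≡⟨ collect (length (dedup X)) (size φ) ⟩
      21 * suc (length (dedup X) + size φ) ∎
      where
      open ≤-Reasoning
      collect : ∀ l s → suc (l + 21 * s) + (20 * l + 20) ≡ 21 * suc (l + s)
      collect = solve-∀

    mcAuxVec-size : ∀ {k} b (as : Vec Formula k) → sizeVec (mcAuxVec b as) ≤ 21 * sizeVec as
    mcAuxVec-size b []       = z≤n
    mcAuxVec-size b (a ∷ as) =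
      ≤-trans (+-mono-≤ (mcAux-size b a) (mcAuxVec-size b as)) (≤-reflexive (sym (*-distribˡ-+ 21 (size a) (sizeVec as))))

  Tr-sound : ∀ Q φ V → evalQ Q (N (step 0 φ)) V (λ U → eval U (Tr Q φ)) ≡ eval V φ
  Tr-sound Q φ = TrAux-sound Q (depth φ) 0 φ ≤-refl

  Tr-equisatisfiable : ∀ φ → Satisfiable φ ⇔ Satisfiable (Tr ex φ)
  Tr-equisatisfiable φ = mk⇔
    (λ (V , ⊨φ) → let (U , _ , ⊨Tr) = ∃-elim (N (step 0 φ)) V (trans (Tr-sound ex φ V) ⊨φ) in U , ⊨Tr)
    (λ (U , ⊨Tr) → U , trans (sym (Tr-sound ex φ U))
                             (∃-intro (eval-extensional (Tr ex φ)) (N (step 0 φ)) U U (λ _ _ → refl) ⊨Tr))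

  Tr-equivalid : ∀ φ → Valid φ ⇔ Valid (Tr all φ)
  Tr-equivalid φ = mk⇔
    (λ ⊨φ V → ∀-elim (eval-extensional (Tr all φ)) (N (step 0 φ)) V V (λ _ _ → refl)
                     (trans (Tr-sound all φ V) (⊨φ V)))
    (λ ⊨Tr V → trans (sym (Tr-sound all φ V)) (∀-intro (N (step 0 φ)) V (λ U _ → ⊨Tr U)))

theorem1 : (S : Signature) → let open QBF S in
    ((φ : Formula) →
        (Satisfiable φ ⇔ Satisfiable (Tr ex φ))
      × (Valid φ ⇔ Valid (Tr all φ))
      × (φ ≋ Trmc φ)
      × ((Q : Quant) → Prenex (Tr Q φ))
      × BoolCombPrenex (Trmc φ)
      × ((Q : Quant) → depth (Tr Q φ) ≡ depth φ)
      × depth (Trmc φ) ≡ depth φ)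
    × Σ ℕ (λ c → (φ : Formula) →
        ((Q : Quant) → size (Tr Q φ) ≤ c * size φ) × size (Trmc φ) ≤ c * size φ)
theorem1 S =
    (λ φ → Tr-equisatisfiable φ
         , Tr-equivalid φ
         , (λ V → sym (mcAux-sound (bound φ) φ V))
         , (λ Q → TrAux-prenex Q (depth φ) 0 φ ≤-refl)
         , mcAux-boolCombPrenex (bound φ) φ
         , (λ Q → TrAux-depth Q (depth φ) 0 φ ≤-refl)
         , mcAux-depth (bound φ) φ)
  , 21 , λ φ → (λ Q → Tr-size Q φ) , mcAux-size (bound φ) φ
  where
  open QBF S
  open Translation S
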